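{- Let $d\ge1$, let $\mathcal{W}_d=\{(\lambda_1,\dots,\lambda_d)\in\mathbb{Z}^d:\lambda_1>\dots>\lambda_d\}$ with adjacency given by Euclidean distance $1$ and rank $r(\lambda)=\sum_i\lambda_i-\binom{d+1}{2}$, and let $R,L$ be the raising and lowering operators on $\mathbb{C}[\mathcal{W}_d]$: $R(u)$ is the sum of the neighbours $v$ of $u$ with $r(v)=r(u)+1$, and $L(u)$ is the sum of the neighbours $w$ of $u$ with $r(w)=r(u)-1$. For a word $W$ in the letters $L,R$ and $\mu,\lambda\in\mathcal{W}_d$, let $Z_d(W;\mu,\lambda)$ denote the coefficient of $\lambda$ in $W(\mu)$. Let $\mu,\lambda\in\mathcal{W}_d$ with $r(\mu)\le r(\lambda)$, put $k=r(\lambda)-r(\mu)$, and let $W_0,W_1,W_2,\dots$ be any sequence of words in $L,R$ such that $W_n$ contains exactly $n$ letters $L$ and exactly $n+k$ letters $R$. Then $$\sum_{n\ge0} Z_d(W_n;\mu,\lambda)\,\frac{x^{2n+k}}{n!\,(n+k)!}=\det\big(I_{\lambda_i-\mu_j}(2x)\big)_{1\le i,j\le d}.$$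
   Context: $I_m$ is the modified Bessel function: for $m\in\mathbb{Z}$, $I_m(2x)=\sum_{n\ge0}\frac{x^n}{\Gamma(n+1)}\frac{x^{n+m}}{\Gamma(n+m+1)}$ (with $1/\Gamma$ of a nonpositive integer equal to $0$), and $I_{ -m}=I_m$. Note $Z_d(W;\mu,\lambda)$ counts walks from $\mu$ to $\lambda$ in $\mathcal{W}_d$ whose sequence of rank-increasing/decreasing steps is prescribed by $W$ (read right to left). -}

module Defs where

open import Data.Nat as ℕ using (ℕ; zero; suc; _!)
open import Data.Nat.Properties using (_!≢0; _!*_!≢0)
open import Data.Nat.Combinatorics using (_C_)
open import Data.Integer as ℤ using (ℤ; +_; ∣_∣)
import Data.Integer.Properties as ℤP
open import Data.Rational as ℚ using (ℚ; 0ℚ; 1ℚ)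
open import Data.Fin using (Fin; zero; suc; toℕ)
open import Data.Vec as Vec using (Vec; []; _∷_; lookup; updateAt; allFin)
open import Data.Vec.Properties using (≡-dec)
open import Data.List as List using (List; []; _∷_; concatMap; filter; length; upTo)
open import Data.Product using (_×_; _,_)
open import Data.Unit using (⊤; tt)
open import Relation.Nullary using (Dec; yes; no; _×-dec_)
open import Relation.Binary.PropositionalEquality using (_≡_)

StrictDec : ∀ {n} → Vec ℤ n → Set
StrictDec []           = ⊤
StrictDec (x ∷ [])     = ⊤
StrictDec (x ∷ y ∷ xs) = (y ℤ.< x) × StrictDec (y ∷ xs)

strictDec? : ∀ {n} (v : Vec ℤ n) → Dec (StrictDec v)
strictDec? []           = yes tt
strictDec? (x ∷ [])     = yes tt
strictDec? (x ∷ y ∷ xs) = (y ℤ.<? x) ×-dec strictDec? (y ∷ xs)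

InW : ∀ d → Vec ℤ d → Set
InW d v = StrictDec v

rank : ∀ d → Vec ℤ d → ℤ
rank d v = Vec.foldr _ ℤ._+_ (+ 0) v ℤ.- + (suc d C 2)

-- the integer points at Euclidean distance 1 from u: u ± e_i
distOneCandidates : ∀ {d} → Vec ℤ d → List (Vec ℤ d)
distOneCandidates {d} u =
  concatMap (λ i → updateAt u i (ℤ._+ + 1) ∷ updateAt u i (ℤ._- + 1) ∷ [])
            (Vec.toList (allFin d))

data Letter : Set where
  L R : Letter

step : ∀ d → Letter → Vec ℤ d → List (Vec ℤ d)
step d R u = filter (λ v → strictDec? v ×-dec (rank d v ℤ.≟ rank d u ℤ.+ + 1))
                    (distOneCandidates u)
step d L u = filter (λ v → strictDec? v ×-dec (rank d v ℤ.≟ rank d u ℤ.- + 1))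
                    (distOneCandidates u)

-- W(u) as a multiset (list) of basis vectors; a word is read right to left:
-- (a ∷ W)(u) = a(W(u)).
applyWord : ∀ d → List Letter → Vec ℤ d → List (Vec ℤ d)
applyWord d []      u = u ∷ []
applyWord d (a ∷ W) u = concatMap (step d a) (applyWord d W u)

Z : ∀ d → List Letter → Vec ℤ d → Vec ℤ d → ℕ
Z d W μ ν = length (filter (λ v → ≡-dec ℤ._≟_ v ν) (applyWord d W μ))

_≟L_ : (a b : Letter) → Dec (a ≡ b)
L ≟L L = yes _≡_.refl
R ≟L R = yes _≡_.refl
L ≟L R = no (λ ())
R ≟L L = no (λ ())

countLetter : Letter → List Letter → ℕ
countLetter a W = length (filter (λ b → b ≟L a) W)

PS : Set
PS = ℕ → ℚ

sumℚ : List ℚ → ℚ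
sumℚ = List.foldr ℚ._+_ 0ℚ

Σ≤ : ℕ → (ℕ → ℚ) → ℚ
Σ≤ m f = sumℚ (List.map f (upTo (suc m)))

_⊕_ : PS → PS → PS
(f ⊕ g) m = f m ℚ.+ g m

⊖_ : PS → PS
(⊖ f) m = ℚ.- (f m)

_⊛_ : PS → PS → PS
(f ⊛ g) m = Σ≤ m (λ i → f i ℚ.* g (m ℕ.∸ i))

onePS : PS
onePS zero    = 1ℚ
onePS (suc _) = 0ℚ

zeroPS : PS
zeroPS _ = 0ℚ

invFacts : ℕ → ℕ → ℚ
invFacts a b = ((+ 1) ℚ./ (a ! ℕ.* b !)) {{a !* b !≢0}}

ind : ∀ {P : Set} → Dec P → ℚ → ℚ
ind (yes _) q = q
ind (no _)  q = 0ℚ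

-- I_m(2x) = Σ_{n≥0} x^{2n+m} / (n! Γ(n+m+1)),   1/Γ(nonpositive integer) = 0.
-- Coefficient of x^j: only n ≤ j + |m| can contribute.
besselI2x : ℤ → PS
besselI2x m j =
  Σ≤ (j ℕ.+ ∣ m ∣) (λ n →
    ind ((+ 0 ℤ.≤? + n ℤ.+ m) ×-dec ((+ (2 ℕ.* n)) ℤ.+ m ℤ.≟ + j))
        (invFacts n ∣ + n ℤ.+ m ∣))

removeAt : ∀ {n} {A : Set} → (Fin (suc n) → A) → Fin (suc n) → Fin n → A
removeAt f zero    k       = f (suc k)
removeAt f (suc j) zero    = f zero
removeAt {suc n} f (suc j) (suc k) = removeAt (λ i → f (suc i)) j k

signed : ℕ → PS → PS
signed i f = if-even i
  where
    if-even : ℕ → PS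
    if-even zero          = f
    if-even (suc zero)    = ⊖ f
    if-even (suc (suc k)) = if-even k

det : ∀ n → (Fin n → Fin n → PS) → PS
det zero    M = onePS
det (suc n) M =
  List.foldr _⊕_ zeroPS
    (List.map (λ j → signed (toℕ j)
                       (M zero j ⊛ det n (λ a b → removeAt (M (suc a)) j b)))
              (Vec.toList (allFin (suc n))))

besselSeriesLHS : ℕ → (ℕ → ℕ) → PS
besselSeriesLHS k c m =
  Σ≤ m (λ n → ind (2 ℕ.* n ℕ.+ k ℕ.≟ m)
                  (((+ c n) ℚ./ (n ! ℕ.* (n ℕ.+ k) !)) {{n !* (n ℕ.+ k) !≢0}}))

module Submission where

-- Proposition 2.2.  Fix μ and let F_ν = det (I_{ν_i − μ_j}(2x)) for every ν ∈ ℤ^d, a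
-- power series with rational coefficients.  For a word V with r letters R and s
-- letters L we prove Z_d(V; μ, ν) = r! s! [x^{r+s}] F_ν by induction on V, and that
-- [x^m] F_ν = 0 unless m = r + s with r − s = r(ν) − r(μ); the theorem is then a
-- matter of extracting the coefficient of x^m.  The ingredients, in file order:
--   * ℕ, ℤ → ℚ, finite sums, power series (product, X = multiplication by x, and
--     E = q (θ + t) with θ = x d/dx), determinants by Laplace expansion with a
--     Leibniz rule for E, and vanishing of determinants with equal adjacent rows;
--   * the recurrences x I_{s∓1}(2x) = ½ (θ ± s) I_s(2x), which give the neighbour
--     sums x Σ_i F_{ν∓e_i} = ½ (θ ± K_ν) F_ν with K_ν = r(ν) − r(μ), and F_ν(0) = [ν = μ];
--   * F_ν = 0 on the boundary of the chamber, so the neighbour sums may be restricted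
--     to steps inside W_d, and the walk recursion Z(a V; μ, ν) = Σ_{ν′} Z(V; μ, ν′)
--     over the steps ν′ from ν in the opposite direction (W_d is a symmetric graph).

open import Data.Nat as ℕ using (ℕ; zero; suc; _<_; _≤_; _∸_; s≤s; z≤n; _!)
import Data.Nat.Properties as ℕP
open import Data.Integer as ℤ using (ℤ; +_; -[1+_]; _⊖_; ∣_∣)
import Data.Integer.Properties as ℤP
open import Data.Rational as ℚ using (ℚ; 0ℚ; 1ℚ; _+_; _*_; -_; _-_; ½)
open import Data.Rational.Properties
import Data.Rational.Unnormalised as ℚᵘ
import Data.Rational.Unnormalised.Properties as ℚᵘP
open import Data.Vec using (Vec; lookup)
open import Data.List using (List)
open import Data.Product using (Σ; _×_; _,_; proj₁; proj₂)
open import Data.Empty using (⊥; ⊥-elim)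
open import Function using (_∘_)
open import Relation.Nullary using (Dec; yes; no; ¬_)
open import Relation.Binary.PropositionalEquality
open import Data.Nat.Properties using (_!≢0; _!*_!≢0)
open import Data.Rational.Solver using (module +-*-Solver)
import Data.Nat.Solver
open import Algebra.Bundles using (AbelianGroup)
import Data.Integer.Solver as ℤSolver
open import Defs

open +-*-Solver
module ℤS = ℤSolver.+-*-Solver
module ℕS = Data.Nat.Solver.+-*-Solver

module Embedding where

  -- ι n is n viewed as a rational; the recursive definition makes its laws easy.
  ι : ℕ → ℚ
  ι zero    = 0ℚ
  ι (suc n) = 1ℚ + ι n

  ι-+ : ∀ a b → ι (a ℕ.+ b) ≡ ι a + ι b
  ι-+ zero    b = sym (+-identityˡ (ι b))
  ι-+ (suc a) b = trans (cong (λ t → 1ℚ + t) (ι-+ a b)) (sym (+-assoc 1ℚ (ι a) (ι b)))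

  ι-* : ∀ a b → ι (a ℕ.* b) ≡ ι a * ι b
  ι-* zero    b = sym (*-zeroˡ (ι b))
  ι-* (suc a) b = begin
    ι (b ℕ.+ a ℕ.* b)    ≡⟨ ι-+ b (a ℕ.* b) ⟩
    ι b + ι (a ℕ.* b)    ≡⟨ cong (λ t → ι b + t) (ι-* a b) ⟩
    ι b + ι a * ι b      ≡⟨ solve 2 (λ x y → y :+ x :* y := (con 1ℚ :+ x) :* y) refl (ι a) (ι b) ⟩
    (1ℚ + ι a) * ι b     ∎
    where open ≡-Reasoning

  ι-∸ : ∀ m i → i ≤ m → ι (m ∸ i) + ι i ≡ ι m
  ι-∸ m i i≤m = trans (sym (ι-+ (m ∸ i) i)) (cong ι (ℕP.m∸n+n≡m i≤m))

  ι≃ : ∀ n → ℚ.toℚᵘ (ι n) ℚᵘ.≃ ℚᵘ.mkℚᵘ (+ n) 0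
  ι≃ zero    = ℚᵘP.≃-refl
  ι≃ (suc n) = ℚᵘP.≃-trans (toℚᵘ-homo-+ 1ℚ (ι n))
    (ℚᵘP.≃-trans (ℚᵘP.+-congʳ ℚᵘ.1ℚᵘ (ι≃ n)) (ℚᵘ.*≡* (ℤS.solve 1
      (λ x → ((ℤS.con (+ 1) ℤS.:* ℤS.con (+ 1)) ℤS.:+ (x ℤS.:* ℤS.con (+ 1))) ℤS.:* ℤS.con (+ 1)
         ℤS.:= (ℤS.con (+ 1) ℤS.:+ x) ℤS.:* (ℤS.con (+ 1) ℤS.:* ℤS.con (+ 1))) refl (+ n))))

  /-*-ι : ∀ z N .{{_ : ℕ.NonZero N}} → ((+ z) ℚ./ N) * ι N ≡ ι z
  /-*-ι z (suc k) = toℚᵘ-injective (ℚᵘP.≃-trans (toℚᵘ-homo-* ((+ z) ℚ./ suc k) (ι (suc k)))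
    (ℚᵘP.≃-trans (ℚᵘP.*-cong (toℚᵘ-fromℚᵘ (ℚᵘ.mkℚᵘ (+ z) k)) (ι≃ (suc k)))
      (ℚᵘP.≃-trans (ℚᵘ.*≡* (ℤS.solve 2 (λ a b → (a ℤS.:* b) ℤS.:* ℤS.con (+ 1)
                                          ℤS.:= a ℤS.:* (b ℤS.:* ℤS.con (+ 1))) refl (+ z) (+ suc k)))
        (ℚᵘP.≃-sym (ι≃ z)))))

  /-unique : ∀ z N .{{_ : ℕ.NonZero N}} q → ι z ≡ ι N * q → ((+ z) ℚ./ N) ≡ q
  /-unique z N q eq = begin
    x                                  ≡⟨ solve 3 (λ x c i → x := x :* (c :* i) :+ x :* (con 1ℚ :+ (:- (i :* c)))) refl x c i ⟩
    x * (c * i) + x * (1ℚ + - (i * c)) ≡⟨ cong (λ t → x * (c * i) + x * (1ℚ + - t)) i*c≡1 ⟩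
    x * (c * i) + x * (1ℚ + - 1ℚ)      ≡⟨ cong (_+ x * (1ℚ + - 1ℚ)) (sym (*-assoc x c i)) ⟩
    (x * c) * i + x * (1ℚ + - 1ℚ)      ≡⟨ cong (λ t → t * i + x * (1ℚ + - 1ℚ)) (trans (/-*-ι z N) eq) ⟩
    (c * q) * i + x * (1ℚ + - 1ℚ)      ≡⟨ solve 4 (λ x c i q → (c :* q) :* i :+ x :* (con 1ℚ :+ (:- con 1ℚ)) := q :* (i :* c)) refl x c i q ⟩
    q * (i * c)                        ≡⟨ cong (q *_) i*c≡1 ⟩
    q * 1ℚ                             ≡⟨ *-identityʳ q ⟩
    q                                  ∎
    where
    open ≡-Reasoning
    x c i : ℚ
    x = (+ z) ℚ./ N
    c = ι N
    i = (+ 1) ℚ./ N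
    i*c≡1 : i * c ≡ 1ℚ
    i*c≡1 = trans (/-*-ι 1 N) (+-identityʳ 1ℚ)

  ι-suc-cancel : ∀ m q → ι (suc m) * q ≡ 0ℚ → q ≡ 0ℚ
  ι-suc-cancel m q eq = begin
    q                                   ≡⟨ solve 3 (λ q i c → q := (i :* c) :* q :+ q :* (con 1ℚ :+ (:- (i :* c)))) refl q i c ⟩
    (i * c) * q + q * (1ℚ + - (i * c))  ≡⟨ cong (_+ q * (1ℚ + - (i * c))) (*-assoc i c q) ⟩
    i * (c * q) + q * (1ℚ + - (i * c))  ≡⟨ cong₂ (λ t u → i * t + q * (1ℚ + - u)) eq i*c≡1 ⟩
    i * 0ℚ + q * (1ℚ + - 1ℚ)            ≡⟨ solve 2 (λ i q → i :* con 0ℚ :+ q :* (con 1ℚ :+ (:- con 1ℚ)) := con 0ℚ) refl i q ⟩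
    0ℚ                                  ∎
    where
    open ≡-Reasoning
    c i : ℚ
    c = ι (suc m)
    i = (+ 1) ℚ./ suc m
    i*c≡1 : i * c ≡ 1ℚ
    i*c≡1 = trans (/-*-ι 1 (suc m)) (+-identityʳ 1ℚ)

  ιℤ : ℤ → ℚ
  ιℤ (+ n)    = ι n
  ιℤ -[1+ n ] = - ι (suc n)

  ιℤ-⊖ : ∀ u v → ιℤ (u ⊖ v) ≡ ι u - ι v
  ιℤ-⊖ u zero = trans (cong ιℤ (ℤP.⊖-≥ {u} {0} z≤n)) (solve 1 (λ x → x := x :- con 0ℚ) refl (ι u))
  ιℤ-⊖ zero (suc v) = trans (cong ιℤ (ℤP.⊖-< {0} {suc v} (s≤s z≤n))) (solve 1 (λ x → :- x := con 0ℚ :- x) refl (ι (suc v)))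
  ιℤ-⊖ (suc u) (suc v) = trans (cong ιℤ (ℤP.[1+m]⊖[1+n]≡m⊖n u v)) (trans (ιℤ-⊖ u v)
    (solve 2 (λ x y → x :- y := (con 1ℚ :+ x) :- (con 1ℚ :+ y)) refl (ι u) (ι v)))

  ⊖-surjective : ∀ x → Σ ℕ λ a → Σ ℕ λ b → x ≡ a ⊖ b
  ⊖-surjective (+ n)    = n , 0 , sym (ℤP.⊖-≥ z≤n)
  ⊖-surjective -[1+ n ] = 0 , suc n , sym (ℤP.⊖-< (s≤s z≤n))

  ιℤ-+ : ∀ x y → ιℤ (x ℤ.+ y) ≡ ιℤ x + ιℤ y
  ιℤ-+ x y with ⊖-surjective x | ⊖-surjective y
  ... | a , b , refl | c , d , refl = begin
    ιℤ ((a ⊖ b) ℤ.+ (c ⊖ d))      ≡⟨ cong ιℤ ⊖-+-⊖ ⟩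
    ιℤ ((a ℕ.+ c) ⊖ (b ℕ.+ d))    ≡⟨ ιℤ-⊖ (a ℕ.+ c) (b ℕ.+ d) ⟩
    ι (a ℕ.+ c) - ι (b ℕ.+ d)     ≡⟨ cong₂ _-_ (ι-+ a c) (ι-+ b d) ⟩
    (ι a + ι c) - (ι b + ι d)     ≡⟨ solve 4 (λ a b c d → (a :+ c) :- (b :+ d) := (a :- b) :+ (c :- d)) refl (ι a) (ι b) (ι c) (ι d) ⟩
    (ι a - ι b) + (ι c - ι d)     ≡⟨ sym (cong₂ _+_ (ιℤ-⊖ a b) (ιℤ-⊖ c d)) ⟩
    ιℤ (a ⊖ b) + ιℤ (c ⊖ d)       ∎
    where
    open ≡-Reasoning
    ⊖-+-⊖ : (a ⊖ b) ℤ.+ (c ⊖ d) ≡ (a ℕ.+ c) ⊖ (b ℕ.+ d)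
    ⊖-+-⊖ = begin
      (a ⊖ b) ℤ.+ (c ⊖ d)
        ≡⟨ sym (cong₂ ℤ._+_ (ℤP.m-n≡m⊖n a b) (ℤP.m-n≡m⊖n c d)) ⟩
      (+ a ℤ.- + b) ℤ.+ (+ c ℤ.- + d)
        ≡⟨ ℤS.solve 4 (λ a b c d → (a ℤS.:- b) ℤS.:+ (c ℤS.:- d) ℤS.:= (a ℤS.:+ c) ℤS.:- (b ℤS.:+ d)) refl (+ a) (+ b) (+ c) (+ d) ⟩
      (+ a ℤ.+ + c) ℤ.- (+ b ℤ.+ + d)
        ≡⟨ ℤP.m-n≡m⊖n (a ℕ.+ c) (b ℕ.+ d) ⟩
      (a ℕ.+ c) ⊖ (b ℕ.+ d) ∎

  ιℤ-neg : ∀ x → ιℤ (ℤ.- x) ≡ - ιℤ x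
  ιℤ-neg x with ⊖-surjective x
  ... | a , b , refl = trans (cong ιℤ (sym (ℤP.⊖-swap b a))) (trans (ιℤ-⊖ b a)
    (trans (solve 2 (λ x y → y :- x := :- (x :- y)) refl (ι a) (ι b)) (cong -_ (sym (ιℤ-⊖ a b)))))

  ιℤ-- : ∀ x y → ιℤ (x ℤ.- y) ≡ ιℤ x - ιℤ y
  ιℤ-- x y = trans (ιℤ-+ x (ℤ.- y)) (cong (λ t → ιℤ x + t) (ιℤ-neg y))

module FiniteSums where

  open import Data.List using (applyUpTo)
  import Data.List.Properties as ListP

  Σ< : ℕ → (ℕ → ℚ) → ℚ
  Σ< zero    f = 0ℚ
  Σ< (suc n) f = f 0 + Σ< n (f ∘ suc)

  Σ≤-as-Σ< : ∀ m f → Σ≤ m f ≡ Σ< (suc m) f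
  Σ≤-as-Σ< m f = trans (cong sumℚ (ListP.map-applyUpTo (λ x → x) f (suc m))) (sum-applyUpTo (suc m) f)
    where
    sum-applyUpTo : ∀ n f → sumℚ (applyUpTo f n) ≡ Σ< n f
    sum-applyUpTo zero    f = refl
    sum-applyUpTo (suc n) f = cong (λ t → f 0 + t) (sum-applyUpTo n (f ∘ suc))

  Σ<-cong : ∀ n {f g} → (∀ i → i < n → f i ≡ g i) → Σ< n f ≡ Σ< n g
  Σ<-cong zero    h = refl
  Σ<-cong (suc n) h = cong₂ _+_ (h 0 (s≤s z≤n)) (Σ<-cong n (λ i i<n → h (suc i) (s≤s i<n)))

  Σ<-cong′ : ∀ n {f g} → (∀ i → f i ≡ g i) → Σ< n f ≡ Σ< n g
  Σ<-cong′ n h = Σ<-cong n (λ i _ → h i)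

  Σ<-snoc : ∀ n f → Σ< (suc n) f ≡ Σ< n f + f n
  Σ<-snoc zero    f = +-comm (f 0) 0ℚ
  Σ<-snoc (suc n) f = trans (cong (λ t → f 0 + t) (Σ<-snoc n (f ∘ suc))) (sym (+-assoc (f 0) _ _))

  Σ<-+ : ∀ n f g → Σ< n (λ i → f i + g i) ≡ Σ< n f + Σ< n g
  Σ<-+ zero    f g = refl
  Σ<-+ (suc n) f g = trans (cong (λ t → (f 0 + g 0) + t) (Σ<-+ n (f ∘ suc) (g ∘ suc)))
    (solve 4 (λ a b c d → (a :+ b) :+ (c :+ d) := (a :+ c) :+ (b :+ d)) refl (f 0) (g 0) (Σ< n (f ∘ suc)) (Σ< n (g ∘ suc)))

  Σ<-*ˡ : ∀ n c f → Σ< n (λ i → c * f i) ≡ c * Σ< n f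
  Σ<-*ˡ zero    c f = sym (*-zeroʳ c)
  Σ<-*ˡ (suc n) c f = trans (cong (λ t → c * f 0 + t) (Σ<-*ˡ n c (f ∘ suc))) (sym (*-distribˡ-+ c (f 0) _))

  Σ<-neg : ∀ n f → Σ< n (λ i → - f i) ≡ - Σ< n f
  Σ<-neg zero    f = refl
  Σ<-neg (suc n) f = trans (cong (λ t → - f 0 + t) (Σ<-neg n (f ∘ suc))) (sym (neg-distrib-+ (f 0) _))

  Σ<-zero : ∀ n {f} → (∀ i → i < n → f i ≡ 0ℚ) → Σ< n f ≡ 0ℚ
  Σ<-zero zero    h = refl
  Σ<-zero (suc n) h = trans (cong₂ _+_ (h 0 (s≤s z≤n)) (Σ<-zero n (λ i i<n → h (suc i) (s≤s i<n)))) (+-identityˡ 0ℚ)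

  Σ<-single : ∀ n {f} j → j < n → (∀ i → i < n → i ≢ j → f i ≡ 0ℚ) → Σ< n f ≡ f j
  Σ<-single (suc n) {f} zero j<n h =
    trans (cong (λ t → f 0 + t) (Σ<-zero n (λ i i<n → h (suc i) (s≤s i<n) (λ ())))) (+-identityʳ _)
  Σ<-single (suc n) {f} (suc j) (s≤s j<n) h = trans (cong (_+ Σ< n (f ∘ suc)) (h 0 (s≤s z≤n) (λ ())))
    (trans (+-identityˡ _) (Σ<-single n j j<n (λ i i<n i≢j → h (suc i) (s≤s i<n) (i≢j ∘ ℕP.suc-injective))))

  Σ<-reverse : ∀ n f → Σ< n f ≡ Σ< n (λ i → f (n ∸ suc i))
  Σ<-reverse zero    f = refl
  Σ<-reverse (suc n) f = trans (Σ<-snoc n f) (trans (cong (_+ f n) (Σ<-reverse n f)) (+-comm _ (f n)))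

  Triangle : ℕ → (ℕ → ℕ → ℚ) → ℚ
  Triangle n T = Σ< n (λ i → Σ< (n ∸ i) (T i))

  Triangle-peel : ∀ n (T : ℕ → ℕ → ℚ) → Triangle (suc n) T
    ≡ (T 0 0 + Σ< n (λ a → T 0 (suc a))) + (Σ< n (λ i → T (suc i) 0) + Triangle (n ∸ 1) (λ i a → T (suc i) (suc a)))
  Triangle-peel n T = cong (λ t → Σ< (suc n) (T 0) + t) (columns n T)
    where
    open ≡-Reasoning
    columns : ∀ n (T : ℕ → ℕ → ℚ) → Triangle n (λ i → T (suc i))
      ≡ Σ< n (λ i → T (suc i) 0) + Triangle (n ∸ 1) (λ i a → T (suc i) (suc a))
    columns zero    T = sym (+-identityˡ 0ℚ)
    columns (suc n) T = begin
      Σ< (suc n) (T 1) + Triangle n (λ i → T (suc (suc i)))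
        ≡⟨ cong (λ t → Σ< (suc n) (T 1) + t) (columns n (λ i → T (suc i))) ⟩
      (T 1 0 + A) + (B + C)
        ≡⟨ solve 4 (λ a b c d → (a :+ b) :+ (c :+ d) := (a :+ c) :+ (b :+ d)) refl (T 1 0) A B C ⟩
      (T 1 0 + B) + (A + C)
        ≡⟨ cong (λ t → (T 1 0 + B) + t) (first-row n) ⟩
      (T 1 0 + B) + Triangle n (λ i a → T (suc i) (suc a)) ∎
      where
      A B C : ℚ
      A = Σ< n (λ a → T 1 (suc a))
      B = Σ< n (λ i → T (suc (suc i)) 0)
      C = Triangle (n ∸ 1) (λ i a → T (suc (suc i)) (suc a))
      first-row : ∀ n → Σ< n (λ a → T 1 (suc a)) + Triangle (n ∸ 1) (λ i a → T (suc (suc i)) (suc a))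
                        ≡ Triangle n (λ i a → T (suc i) (suc a))
      first-row zero    = +-identityʳ 0ℚ
      first-row (suc n) = refl

  Triangle-swap : ∀ n (T : ℕ → ℕ → ℚ) → Triangle n T ≡ Triangle n (λ i a → T a i)
  Triangle-swap zero          T = refl
  Triangle-swap (suc zero)    T = refl
  Triangle-swap (suc (suc n)) T = begin
    Triangle (suc (suc n)) T
      ≡⟨ Triangle-peel (suc n) T ⟩
    (T 0 0 + A) + (B + Triangle n (λ i a → T (suc i) (suc a)))
      ≡⟨ cong (λ t → (T 0 0 + A) + (B + t)) (Triangle-swap n (λ i a → T (suc i) (suc a))) ⟩
    (T 0 0 + A) + (B + Triangle n (λ i a → T (suc a) (suc i)))
      ≡⟨ solve 4 (λ a b c d → (a :+ b) :+ (c :+ d) := (a :+ c) :+ (b :+ d)) refl (T 0 0) A B _ ⟩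
    (T 0 0 + B) + (A + Triangle n (λ i a → T (suc a) (suc i)))
      ≡⟨ sym (Triangle-peel (suc n) (λ i a → T a i)) ⟩
    Triangle (suc (suc n)) (λ i a → T a i) ∎
    where
    open ≡-Reasoning
    A B : ℚ
    A = Σ< (suc n) (λ a → T 0 (suc a))
    B = Σ< (suc n) (λ i → T (suc i) 0)

module Series where

  open Embedding
  open FiniteSums

  infix 4 _≈_
  -- Coefficientwise equality of series (there is no function extensionality).
  _≈_ : PS → PS → Set
  f ≈ g = ∀ m → f m ≡ g m

  ⊛-as-Σ< : ∀ f g m → (f ⊛ g) m ≡ Σ< (suc m) (λ i → f i * g (m ∸ i))
  ⊛-as-Σ< f g m = Σ≤-as-Σ< m (λ i → f i * g (m ∸ i))

  ⊛-cong : ∀ {f f′ g g′} → f ≈ f′ → g ≈ g′ → f ⊛ g ≈ f′ ⊛ g′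
  ⊛-cong {f} {f′} {g} {g′} ef eg m = trans (⊛-as-Σ< f g m)
    (trans (Σ<-cong′ (suc m) (λ i → cong₂ _*_ (ef i) (eg (m ∸ i)))) (sym (⊛-as-Σ< f′ g′ m)))

  ⊛-congʳ : ∀ f {g g′} → g ≈ g′ → f ⊛ g ≈ f ⊛ g′
  ⊛-congʳ f = ⊛-cong {f} {f} (λ _ → refl)

  ⊛-comm : ∀ f g → f ⊛ g ≈ g ⊛ f
  ⊛-comm f g m = begin
    (f ⊛ g) m                                          ≡⟨ ⊛-as-Σ< f g m ⟩
    Σ< (suc m) (λ i → f i * g (m ∸ i))                 ≡⟨ Σ<-reverse (suc m) (λ i → f i * g (m ∸ i)) ⟩
    Σ< (suc m) (λ i → f (m ∸ i) * g (m ∸ (m ∸ i)))     ≡⟨ Σ<-cong (suc m) reflect ⟩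
    Σ< (suc m) (λ i → g i * f (m ∸ i))                 ≡⟨ sym (⊛-as-Σ< g f m) ⟩
    (g ⊛ f) m                                          ∎
    where
    open ≡-Reasoning
    reflect : ∀ i → i < suc m → f (m ∸ i) * g (m ∸ (m ∸ i)) ≡ g i * f (m ∸ i)
    reflect i i<m = trans (cong (λ t → f (m ∸ i) * g t) (ℕP.m∸[m∸n]≡n (ℕP.≤-pred i<m))) (*-comm (f (m ∸ i)) (g i))

  ⊛-distribˡ : ∀ f g h → f ⊛ (g ⊕ h) ≈ (f ⊛ g) ⊕ (f ⊛ h)
  ⊛-distribˡ f g h m = trans (⊛-as-Σ< f (g ⊕ h) m)
    (trans (Σ<-cong′ (suc m) (λ i → *-distribˡ-+ (f i) (g (m ∸ i)) (h (m ∸ i))))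
      (trans (Σ<-+ (suc m) (λ i → f i * g (m ∸ i)) (λ i → f i * h (m ∸ i)))
        (sym (cong₂ _+_ (⊛-as-Σ< f g m) (⊛-as-Σ< f h m)))))

  ⊛-zeroʳ : ∀ f → f ⊛ zeroPS ≈ zeroPS
  ⊛-zeroʳ f m = trans (⊛-as-Σ< f zeroPS m) (Σ<-zero (suc m) (λ i _ → *-zeroʳ (f i)))

  ⊛-negʳ : ∀ f g → f ⊛ (⊖ g) ≈ ⊖ (f ⊛ g)
  ⊛-negʳ f g m = trans (⊛-as-Σ< f (⊖ g) m)
    (trans (Σ<-cong′ (suc m) (λ i → sym (neg-distribʳ-* (f i) (g (m ∸ i)))))
      (trans (Σ<-neg (suc m) (λ i → f i * g (m ∸ i))) (cong -_ (sym (⊛-as-Σ< f g m)))))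

  ⊛-lcomm : ∀ f g h → f ⊛ (g ⊛ h) ≈ g ⊛ (f ⊛ h)
  ⊛-lcomm f g h m = begin
    (f ⊛ (g ⊛ h)) m                                     ≡⟨ ⊛-as-Σ< f (g ⊛ h) m ⟩
    Σ< (suc m) (λ i → f i * (g ⊛ h) (m ∸ i))            ≡⟨ Σ<-cong (suc m) (λ i i<m → sym (inner f g i i<m)) ⟩
    Triangle (suc m) (λ i a → f i * (g a * h (m ∸ i ∸ a))) ≡⟨ Triangle-swap (suc m) (λ i a → f i * (g a * h (m ∸ i ∸ a))) ⟩
    Triangle (suc m) (λ i a → f a * (g i * h (m ∸ a ∸ i))) ≡⟨ Σ<-cong (suc m) (λ i i<m → Σ<-cong′ (suc m ∸ i) (λ a → regroup i a)) ⟩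
    Triangle (suc m) (λ i a → g i * (f a * h (m ∸ i ∸ a))) ≡⟨ Σ<-cong (suc m) (λ i i<m → inner g f i i<m) ⟩
    Σ< (suc m) (λ i → g i * (f ⊛ h) (m ∸ i))            ≡⟨ sym (⊛-as-Σ< g (f ⊛ h) m) ⟩
    (g ⊛ (f ⊛ h)) m                                     ∎
    where
    open ≡-Reasoning
    inner : ∀ p q i → i < suc m → Σ< (suc m ∸ i) (λ a → p i * (q a * h (m ∸ i ∸ a))) ≡ p i * (q ⊛ h) (m ∸ i)
    inner p q i i<m = begin
      Σ< (suc m ∸ i) (λ a → p i * (q a * h (m ∸ i ∸ a)))   ≡⟨ cong (λ k → Σ< k (λ a → p i * (q a * h (m ∸ i ∸ a)))) (ℕP.+-∸-assoc 1 (ℕP.≤-pred i<m)) ⟩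
      Σ< (suc (m ∸ i)) (λ a → p i * (q a * h (m ∸ i ∸ a))) ≡⟨ Σ<-*ˡ (suc (m ∸ i)) (p i) (λ a → q a * h (m ∸ i ∸ a)) ⟩
      p i * Σ< (suc (m ∸ i)) (λ a → q a * h (m ∸ i ∸ a))   ≡⟨ cong (p i *_) (sym (⊛-as-Σ< q h (m ∸ i))) ⟩
      p i * (q ⊛ h) (m ∸ i)                                ∎
    ∸-swap : ∀ a i → m ∸ a ∸ i ≡ m ∸ i ∸ a
    ∸-swap a i = trans (ℕP.∸-+-assoc m a i) (trans (cong (m ∸_) (ℕP.+-comm a i)) (sym (ℕP.∸-+-assoc m i a)))
    regroup : ∀ i a → f a * (g i * h (m ∸ a ∸ i)) ≡ g i * (f a * h (m ∸ i ∸ a))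
    regroup i a = trans (cong (λ t → f a * (g i * h t)) (∸-swap a i))
      (solve 3 (λ x y z → x :* (y :* z) := y :* (x :* z)) refl (f a) (g i) (h (m ∸ i ∸ a)))

  ⊛-at-0 : ∀ f g → (f ⊛ g) 0 ≡ f 0 * g 0
  ⊛-at-0 f g = trans (⊛-as-Σ< f g 0) (+-identityʳ (f 0 * g 0))

  X : PS → PS
  X f zero    = 0ℚ
  X f (suc j) = f j

  X-cong : ∀ {a b} → a ≈ b → X a ≈ X b
  X-cong e zero    = refl
  X-cong e (suc m) = e m

  X-⊛ˡ : ∀ f g → (X f) ⊛ g ≈ X (f ⊛ g)
  X-⊛ˡ f g zero    = trans (⊛-as-Σ< (X f) g 0) (solve 1 (λ a → con 0ℚ :* a :+ con 0ℚ := con 0ℚ) refl (g 0))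
  X-⊛ˡ f g (suc m) = trans (⊛-as-Σ< (X f) g (suc m))
    (trans (cong (_+ Σ< (suc m) (λ i → f i * g (m ∸ i))) (*-zeroˡ (g (suc m))))
      (trans (+-identityˡ _) (sym (⊛-as-Σ< f g m))))

  X-⊛ʳ : ∀ f g → f ⊛ (X g) ≈ X (f ⊛ g)
  X-⊛ʳ f g m = trans (⊛-comm f (X g) m) (trans (X-⊛ˡ g f m) (X-cong (⊛-comm g f) m))

  -- E q t f = q (θ + t) f : the coefficient of x^j is multiplied by q (j + t).
  E : ℚ → ℚ → PS → PS
  E q t f j = q * (ι j + t) * f j

  -- Leibniz rule: θ is a derivation, so E q (t + u) (f g) = (E q t f) g + f (E q u g).
  E-⊛ : ∀ q t u f g → E q (t + u) (f ⊛ g) ≈ (E q t f ⊛ g) ⊕ (f ⊛ E q u g)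
  E-⊛ q t u f g m = begin
    c * (f ⊛ g) m
      ≡⟨ cong (c *_) (⊛-as-Σ< f g m) ⟩
    c * Σ< (suc m) (λ i → f i * g (m ∸ i))
      ≡⟨ sym (Σ<-*ˡ (suc m) c (λ i → f i * g (m ∸ i))) ⟩
    Σ< (suc m) (λ i → c * (f i * g (m ∸ i)))
      ≡⟨ Σ<-cong (suc m) split ⟩
    Σ< (suc m) (λ i → E q t f i * g (m ∸ i) + f i * E q u g (m ∸ i))
      ≡⟨ Σ<-+ (suc m) (λ i → E q t f i * g (m ∸ i)) (λ i → f i * E q u g (m ∸ i)) ⟩
    Σ< (suc m) (λ i → E q t f i * g (m ∸ i)) + Σ< (suc m) (λ i → f i * E q u g (m ∸ i))
      ≡⟨ sym (cong₂ _+_ (⊛-as-Σ< (E q t f) g m) (⊛-as-Σ< f (E q u g) m)) ⟩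
    ((E q t f ⊛ g) ⊕ (f ⊛ E q u g)) m ∎
    where
    open ≡-Reasoning
    c : ℚ
    c = q * (ι m + (t + u))
    split : ∀ i → i < suc m → c * (f i * g (m ∸ i)) ≡ E q t f i * g (m ∸ i) + f i * E q u g (m ∸ i)
    split i i<m = trans (cong (λ z → q * (z + (t + u)) * (f i * g (m ∸ i))) (sym (ι-∸ m i (ℕP.≤-pred i<m))))
      (solve 7 (λ q t u a b fi gi → q :* ((a :+ b) :+ (t :+ u)) :* (fi :* gi) := q :* (b :+ t) :* fi :* gi :+ fi :* (q :* (a :+ u) :* gi))
         refl q t u (ι (m ∸ i)) (ι i) (f i) (g (m ∸ i)))

  neg-involutive : ∀ a → - (- a) ≡ a
  neg-involutive a = solve 1 (λ a → :- (:- a) := a) refl a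

  sg : ℕ → ℚ → ℚ
  sg zero          a = a
  sg (suc zero)    a = - a
  sg (suc (suc k)) a = sg k a

  signed-pointwise : ∀ k f m → signed k f m ≡ sg k (f m)
  signed-pointwise zero          f m = refl
  signed-pointwise (suc zero)    f m = refl
  signed-pointwise (suc (suc k)) f m = signed-pointwise k f m

  sg-suc : ∀ k a → sg (suc k) a ≡ - sg k a
  sg-suc zero          a = refl
  sg-suc (suc zero)    a = sym (neg-involutive a)
  sg-suc (suc (suc k)) a = sg-suc k a

  sg-+ : ∀ k a b → sg k (a + b) ≡ sg k a + sg k b
  sg-+ zero          a b = refl
  sg-+ (suc zero)    a b = neg-distrib-+ a b
  sg-+ (suc (suc k)) a b = sg-+ k a b

  sg-* : ∀ k c a → sg k (c * a) ≡ c * sg k a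
  sg-* zero          c a = refl
  sg-* (suc zero)    c a = neg-distribʳ-* c a
  sg-* (suc (suc k)) c a = sg-* k c a

  sg-0 : ∀ k → sg k 0ℚ ≡ 0ℚ
  sg-0 zero          = refl
  sg-0 (suc zero)    = refl
  sg-0 (suc (suc k)) = sg-0 k

  sg-add : ∀ a b x → sg a (sg b x) ≡ sg (a ℕ.+ b) x
  sg-add zero          b x = refl
  sg-add (suc zero)    b x = sym (sg-suc b x)
  sg-add (suc (suc a)) b x = sg-add a b x

  ⊛-sgʳ : ∀ s f g → f ⊛ (λ k → sg s (g k)) ≈ (λ k → sg s ((f ⊛ g) k))
  ⊛-sgʳ zero          f g k = refl
  ⊛-sgʳ (suc zero)    f g k = ⊛-negʳ f g k
  ⊛-sgʳ (suc (suc s)) f g k = ⊛-sgʳ s f g k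

module Determinants where

  open import Data.Fin using (Fin; zero; suc; toℕ; punchIn)
  open import Data.Vec as Vec using (allFin)
  open import Data.Vec.Properties using (tabulate-∘; toList-map)
  import Data.List as List
  open import Data.List.Properties using (map-∘)
  open import Algebra.Properties.CommutativeMonoid.Sum +-0-commutativeMonoid public
    using (sum; sum-cong-≗; sum-remove; ∑-comm; ∑-distrib-+)
  open Embedding
  open Series

  Mat : ℕ → Set
  Mat n = Fin n → Fin n → PS

  minor : ∀ {n} → Mat (suc n) → Fin (suc n) → Mat n
  minor M j a b = removeAt (M (suc a)) j b

  removeAt-punchIn : ∀ {n} {A : Set} (f : Fin (suc n) → A) j b → removeAt f j b ≡ f (punchIn j b)
  removeAt-punchIn         f zero    b       = refl
  removeAt-punchIn {suc n} f (suc j) zero    = refl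
  removeAt-punchIn {suc n} f (suc j) (suc b) = removeAt-punchIn (f ∘ suc) j b

  sum-*ˡ : ∀ {n} c (g : Fin n → ℚ) → c * sum g ≡ sum (λ j → c * g j)
  sum-*ˡ {zero}  c g = *-zeroʳ c
  sum-*ˡ {suc n} c g = trans (*-distribˡ-+ c (g zero) (sum (g ∘ suc))) (cong (λ t → c * g zero + t) (sum-*ˡ c (g ∘ suc)))

  sum-0 : ∀ {n} (g : Fin n → ℚ) → (∀ j → g j ≡ 0ℚ) → sum g ≡ 0ℚ
  sum-0 {zero}  g h = refl
  sum-0 {suc n} g h = trans (cong₂ _+_ (h zero) (sum-0 (g ∘ suc) (h ∘ suc))) (+-identityˡ 0ℚ)

  sum-neg : ∀ {n} (g : Fin n → ℚ) → sum (λ j → - g j) ≡ - sum g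
  sum-neg {zero}  g = refl
  sum-neg {suc n} g = trans (cong (λ t → - g zero + t) (sum-neg (g ∘ suc))) (sym (neg-distrib-+ (g zero) (sum (g ∘ suc))))

  sum-sg : ∀ {n} k (g : Fin n → ℚ) → sum (λ j → sg k (g j)) ≡ sg k (sum g)
  sum-sg {zero}  k g = sym (sg-0 k)
  sum-sg {suc n} k g = trans (cong (λ t → sg k (g zero) + t) (sum-sg k (g ∘ suc))) (sym (sg-+ k (g zero) (sum (g ∘ suc))))

  ΣPS : ∀ {n} → (Fin n → PS) → PS
  ΣPS G m = sum (λ i → G i m)

  ⊛-ΣPSʳ : ∀ {n} f (G : Fin n → PS) → f ⊛ ΣPS G ≈ ΣPS (λ i → f ⊛ G i)
  ⊛-ΣPSʳ {zero}  f G m = ⊛-zeroʳ f m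
  ⊛-ΣPSʳ {suc n} f G m = trans (⊛-distribˡ f (G zero) (ΣPS (G ∘ suc)) m)
    (cong (λ t → (f ⊛ G zero) m + t) (⊛-ΣPSʳ f (G ∘ suc) m))

  det-expand : ∀ n (M : Mat (suc n)) m →
    det (suc n) M m ≡ sum (λ j → sg (toℕ j) ((M zero j ⊛ det n (minor M j)) m))
  det-expand n M m = trans (foldr-⊕ (suc n) (λ j → signed (toℕ j) (M zero j ⊛ det n (minor M j))))
    (sum-cong-≗ (λ j → signed-pointwise (toℕ j) (M zero j ⊛ det n (minor M j)) m))
    where
    foldr-⊕ : ∀ k (h : Fin k → PS) →
      List.foldr _⊕_ zeroPS (List.map h (Vec.toList (allFin k))) m ≡ sum (λ j → h j m)
    foldr-⊕ zero    h = refl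
    foldr-⊕ (suc k) h = cong (λ t → h zero m + t) (trans (cong (λ l → List.foldr _⊕_ zeroPS l m) tail-list) (foldr-⊕ k (h ∘ suc)))
      where
      tail-list : List.map h (Vec.toList (Vec.tabulate {n = k} suc)) ≡ List.map (h ∘ suc) (Vec.toList (allFin k))
      tail-list = trans (cong (List.map h ∘ Vec.toList) (tabulate-∘ suc (λ x → x)))
                  (trans (cong (List.map h) (toList-map suc (allFin k))) (sym (map-∘ (Vec.toList (allFin k)))))

  det-cong : ∀ n (M N : Mat n) → (∀ a b → M a b ≈ N a b) → det n M ≈ det n N
  det-cong zero    M N e m = refl
  det-cong (suc n) M N e m = trans (det-expand n M m) (trans (sum-cong-≗ (λ j → cong (sg (toℕ j))
      (⊛-cong {M zero j} {N zero j} (e zero j) (det-cong n (minor M j) (minor N j) (minor-≈ j)) m)))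
    (sym (det-expand n N m)))
    where
    minor-≈ : ∀ j a b → minor M j a b ≈ minor N j a b
    minor-≈ j a b k = trans (cong (λ t → t k) (removeAt-punchIn (M (suc a)) j b))
      (trans (e (suc a) (punchIn j b) k) (cong (λ t → t k) (sym (removeAt-punchIn (N (suc a)) j b))))

  replaceRow : ∀ {n} {A : Set} → (Fin n → A) → Fin n → A → Fin n → A
  replaceRow M zero    r zero    = r
  replaceRow M zero    r (suc a) = M (suc a)
  replaceRow M (suc i) r zero    = M zero
  replaceRow M (suc i) r (suc a) = replaceRow (M ∘ suc) i r a

  replaceRow-map : ∀ {n} {A B : Set} (g : A → B) (N : Fin n → A) i r a →
    g (replaceRow N i r a) ≡ replaceRow (g ∘ N) i (g r) a
  replaceRow-map g N zero    r zero    = refl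
  replaceRow-map g N zero    r (suc a) = refl
  replaceRow-map g N (suc i) r zero    = refl
  replaceRow-map g N (suc i) r (suc a) = replaceRow-map g (N ∘ suc) i r a

  replaceRow-cong : ∀ {n k} (N : Fin n → Fin k → PS) i r r′ → (∀ b → r b ≡ r′ b) →
    ∀ a b → replaceRow N i r a b ≡ replaceRow N i r′ a b
  replaceRow-cong N zero    r r′ e zero    b = e b
  replaceRow-cong N zero    r r′ e (suc a) b = refl
  replaceRow-cong N (suc i) r r′ e zero    b = refl
  replaceRow-cong N (suc i) r r′ e (suc a) b = replaceRow-cong (N ∘ suc) i r r′ e a b

  replaceRow-at : ∀ {n} {A : Set} (M : Fin n → A) i r → replaceRow M i r i ≡ r
  replaceRow-at M zero    r = refl
  replaceRow-at M (suc i) r = replaceRow-at (M ∘ suc) i r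

  replaceRow-twice : ∀ {n} {A : Set} (M : Fin n → A) i r₀ r a → replaceRow (replaceRow M i r₀) i r a ≡ replaceRow M i r a
  replaceRow-twice M zero    r₀ r zero    = refl
  replaceRow-twice M zero    r₀ r (suc a) = refl
  replaceRow-twice M (suc i) r₀ r zero    = refl
  replaceRow-twice M (suc i) r₀ r (suc a) = replaceRow-twice (M ∘ suc) i r₀ r a

  replaceRow-≈ : ∀ {n k} (N : Fin n → Fin k → PS) i r r′ → (∀ b → r b ≈ r′ b) → ∀ a b → replaceRow N i r a b ≈ replaceRow N i r′ a b
  replaceRow-≈ N zero    r r′ e zero    b = e b
  replaceRow-≈ N zero    r r′ e (suc a) b = λ _ → refl
  replaceRow-≈ N (suc i) r r′ e zero    b = λ _ → refl
  replaceRow-≈ N (suc i) r r′ e (suc a) b = replaceRow-≈ (N ∘ suc) i r r′ e a b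

  minor-replaceRow : ∀ {n} (M : Mat (suc n)) i (φ : Fin (suc n) → PS → PS) j a b →
    minor (replaceRow M (suc i) (λ b → φ b (M (suc i) b))) j a b
      ≡ replaceRow (minor M j) i (λ b → φ (punchIn j b) (minor M j i b)) a b
  minor-replaceRow M i φ j a b =
    trans (cong (λ t → t b) (replaceRow-map (λ row → removeAt row j) (M ∘ suc) i (λ b → φ b (M (suc i) b)) a))
      (replaceRow-cong (minor M j) i _ _ entry a b)
    where
    entry : ∀ b → removeAt (λ b → φ b (M (suc i) b)) j b ≡ φ (punchIn j b) (minor M j i b)
    entry b = trans (removeAt-punchIn (λ b → φ b (M (suc i) b)) j b)
      (cong (φ (punchIn j b)) (sym (removeAt-punchIn (M (suc i)) j b)))

  ≡⇒≈ : ∀ {f g : PS} → f ≡ g → f ≈ g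
  ≡⇒≈ e k = cong (λ t → t k) e

  det-X-row : ∀ n (M : Mat n) i → det n (replaceRow M i (λ b → X (M i b))) ≈ X (det n M)
  det-X-row (suc n) M i m = begin
    det (suc n) (replaceRow M i r) m
      ≡⟨ det-expand n (replaceRow M i r) m ⟩
    sum (λ j → sg (toℕ j) ((replaceRow M i r zero j ⊛ D′ j) m))
      ≡⟨ signed-X (λ j → replaceRow M i r zero j ⊛ D′ j) (λ j → M zero j ⊛ det n (minor M j)) (term-X i) m ⟩
    X (λ m → sum (λ j → sg (toℕ j) ((M zero j ⊛ det n (minor M j)) m))) m
      ≡⟨ X-cong (λ m → sym (det-expand n M m)) m ⟩
    X (det (suc n) M) m ∎
    where
    open ≡-Reasoning
    r : Fin (suc n) → PS
    r b = X (M i b)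
    D′ : Fin (suc n) → PS
    D′ j = det n (minor (replaceRow M i r) j)
    signed-X : ∀ (P Q : Fin (suc n) → PS) → (∀ j → P j ≈ X (Q j)) →
      (λ m → sum (λ j → sg (toℕ j) (P j m))) ≈ X (λ m → sum (λ j → sg (toℕ j) (Q j m)))
    signed-X P Q e zero    = sum-0 _ (λ j → trans (cong (sg (toℕ j)) (e j 0)) (sg-0 (toℕ j)))
    signed-X P Q e (suc m) = sum-cong-≗ (λ j → cong (sg (toℕ j)) (e j (suc m)))
    term-X : ∀ i j → replaceRow M i (λ b → X (M i b)) zero j ⊛ det n (minor (replaceRow M i (λ b → X (M i b))) j)
                       ≈ X (M zero j ⊛ det n (minor M j))
    term-X zero    j = X-⊛ˡ (M zero j) (det n (minor M j))
    term-X (suc i) j k = trans (⊛-congʳ (M zero j) minor-X k) (X-⊛ʳ (M zero j) (det n (minor M j)) k)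
      where
      minor-X : det n (minor (replaceRow M (suc i) (λ b → X (M (suc i) b))) j) ≈ X (det n (minor M j))
      minor-X k′ = trans (det-cong n _ _ (λ a b → ≡⇒≈ (minor-replaceRow M i (λ _ → X) j a b)) k′)
                         (det-X-row n (minor M j) i k′)

  signed-E-⊛ : ∀ {n} q K (t u : Fin n → ℚ) (f g : Fin n → PS) → (∀ j → t j + u j ≡ K) → ∀ m →
    sum (λ j → sg (toℕ j) ((E q (t j) (f j) ⊛ g j) m)) + sum (λ j → sg (toℕ j) ((f j ⊛ E q (u j) (g j)) m))
      ≡ E q K (λ m → sum (λ j → sg (toℕ j) ((f j ⊛ g j) m))) m
  signed-E-⊛ {n} q K t u f g tu m = begin
    sum A + sum B
      ≡⟨ sym (∑-distrib-+ A B) ⟩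
    sum (λ j → A j + B j)
      ≡⟨ sum-cong-≗ (λ j → sym (sg-+ (toℕ j) ((E q (t j) (f j) ⊛ g j) m) ((f j ⊛ E q (u j) (g j)) m))) ⟩
    sum (λ j → sg (toℕ j) (((E q (t j) (f j) ⊛ g j) ⊕ (f j ⊛ E q (u j) (g j))) m))
                                                      ≡⟨ sum-cong-≗ (λ j → cong (sg (toℕ j)) (leibniz j)) ⟩
    sum (λ j → sg (toℕ j) (c * (f j ⊛ g j) m))
      ≡⟨ sum-cong-≗ (λ j → sg-* (toℕ j) c ((f j ⊛ g j) m)) ⟩
    sum (λ j → c * sg (toℕ j) ((f j ⊛ g j) m))
      ≡⟨ sym (sum-*ˡ c (λ j → sg (toℕ j) ((f j ⊛ g j) m))) ⟩
    c * sum (λ j → sg (toℕ j) ((f j ⊛ g j) m)) ∎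
    where
    open ≡-Reasoning
    c : ℚ
    c = q * (ι m + K)
    A B : Fin n → ℚ
    A j = sg (toℕ j) ((E q (t j) (f j) ⊛ g j) m)
    B j = sg (toℕ j) ((f j ⊛ E q (u j) (g j)) m)
    leibniz : ∀ j → ((E q (t j) (f j) ⊛ g j) ⊕ (f j ⊛ E q (u j) (g j))) m ≡ c * (f j ⊛ g j) m
    leibniz j = trans (sym (E-⊛ q (t j) (u j) (f j) (g j) m)) (cong (λ z → q * (ι m + z) * (f j ⊛ g j) m) (tu j))

  lower-rows-expand : ∀ n (M : Mat (suc n)) (φ : Fin n → Fin (suc n) → PS → PS) m →
    sum (λ i → det (suc n) (replaceRow M (suc i) (λ b → φ i b (M (suc i) b))) m)
      ≡ sum (λ j → sg (toℕ j) ((M zero j ⊛ ΣPS (λ i →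
          det n (replaceRow (minor M j) i (λ b → φ i (punchIn j b) (minor M j i b))))) m))
  lower-rows-expand n M φ m = begin
    sum (λ i → det (suc n) (Mi i) m)
      ≡⟨ sum-cong-≗ (λ i → det-expand n (Mi i) m) ⟩
    sum (λ i → sum (λ j → sg (toℕ j) ((M zero j ⊛ det n (minor (Mi i) j)) m)))
      ≡⟨ ∑-comm (λ i j → sg (toℕ j) ((M zero j ⊛ det n (minor (Mi i) j)) m)) ⟩
    sum (λ j → sum (λ i → sg (toℕ j) ((M zero j ⊛ det n (minor (Mi i) j)) m)))
      ≡⟨ sum-cong-≗ (λ j → sum-sg (toℕ j) (λ i → (M zero j ⊛ det n (minor (Mi i) j)) m)) ⟩
    sum (λ j → sg (toℕ j) (sum (λ i → (M zero j ⊛ det n (minor (Mi i) j)) m)))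
      ≡⟨ sum-cong-≗ (λ j → cong (sg (toℕ j)) (sym (⊛-ΣPSʳ (M zero j) (λ i → det n (minor (Mi i) j)) m))) ⟩
    sum (λ j → sg (toℕ j) ((M zero j ⊛ ΣPS (λ i → det n (minor (Mi i) j))) m))
      ≡⟨ sum-cong-≗ (λ j → cong (sg (toℕ j)) (⊛-congʳ (M zero j) (λ k → sum-cong-≗ (λ i → minor-Mi i j k)) m)) ⟩
    sum (λ j → sg (toℕ j) ((M zero j ⊛ ΣPS (λ i → det n (replaceRow (minor M j) i (λ b → φ i (punchIn j b) (minor M j i b))))) m)) ∎
    where
    open ≡-Reasoning
    Mi : Fin n → Mat (suc n)
    Mi i = replaceRow M (suc i) (λ b → φ i b (M (suc i) b))
    minor-Mi : ∀ i j → det n (minor (Mi i) j) ≈ det n (replaceRow (minor M j) i (λ b → φ i (punchIn j b) (minor M j i b)))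
    minor-Mi i j = det-cong n _ _ (λ a b → ≡⇒≈ (minor-replaceRow M i (φ i) j a b))

  det-E : ∀ n (M : Mat n) q (a c : Fin n → ℚ) m →
    sum (λ i → det n (replaceRow M i (λ b → E q (a i - c b) (M i b))) m) ≡ E q (sum a - sum c) (det n M) m
  det-E zero    M q a c zero    = solve 1 (λ q → con 0ℚ := q :* (con 0ℚ :+ (con 0ℚ :- con 0ℚ)) :* con 1ℚ) refl q
  det-E zero    M q a c (suc m) = solve 2 (λ q x → con 0ℚ := q :* (x :+ (con 0ℚ :- con 0ℚ)) :* con 0ℚ) refl q (ι (suc m))
  det-E (suc n) M q a c m = begin
    det (suc n) (replaceRow M zero (row zero)) m + sum (λ i → det (suc n) (replaceRow M (suc i) (row (suc i))) m)
      ≡⟨ cong₂ _+_ (det-expand n (replaceRow M zero (row zero)) m)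
                   (trans (lower-rows-expand n M (λ i b → E q (a (suc i) - c b)) m)
                          (sum-cong-≗ (λ j → cong (sg (toℕ j)) (⊛-congʳ (M zero j) (det-E n (minor M j) q (a ∘ suc) (c ∘ punchIn j)) m)))) ⟩
    sum (λ j → sg (toℕ j) ((E q (t j) (M zero j) ⊛ D j) m)) + sum (λ j → sg (toℕ j) ((M zero j ⊛ E q (u j) (D j)) m))
      ≡⟨ signed-E-⊛ q (sum a - sum c) t u (M zero) D tu m ⟩
    E q (sum a - sum c) (λ m → sum (λ j → sg (toℕ j) ((M zero j ⊛ D j) m))) m
      ≡⟨ cong (q * (ι m + (sum a - sum c)) *_) (sym (det-expand n M m)) ⟩
    E q (sum a - sum c) (det (suc n) M) m ∎
    where
    open ≡-Reasoning
    row : Fin (suc n) → Fin (suc n) → PS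
    row i b = E q (a i - c b) (M i b)
    D : Fin (suc n) → PS
    D j = det n (minor M j)
    t u : Fin (suc n) → ℚ
    t j = a zero - c j
    u j = sum (a ∘ suc) - sum (c ∘ punchIn j)
    tu : ∀ j → t j + u j ≡ sum a - sum c
    tu j = trans (solve 4 (λ a0 cj sa sc → (a0 :- cj) :+ (sa :- sc) := (a0 :+ sa) :- (cj :+ sc)) refl (a zero) (c j) (sum (a ∘ suc)) (sum (c ∘ punchIn j)))
                 (cong (λ z → sum a - z) (sym (sum-remove {i = j} c)))

module Alternating where

  open import Data.Fin using (Fin; zero; suc; toℕ; punchIn; inject₁)
  import Data.Fin.Properties as FinP
  open import Relation.Binary using (tri<; tri≈; tri>)
  open Embedding
  open Series
  open Determinants

  -- remainingIndex j c: the index of column c once column j (≠ c) is removed.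
  remainingIndex : ∀ {n} → Fin (suc (suc n)) → Fin (suc (suc n)) → Fin (suc n)
  remainingIndex         zero    zero    = zero
  remainingIndex         zero    (suc c) = c
  remainingIndex         (suc j) zero    = zero
  remainingIndex {zero}  (suc j) (suc c) = zero
  remainingIndex {suc n} (suc j) (suc c) = suc (remainingIndex j c)

  remainingIndex-punchIn : ∀ {n} (j : Fin (suc (suc n))) (j′ : Fin (suc n)) → remainingIndex j (punchIn j j′) ≡ j′
  remainingIndex-punchIn         zero    j′       = refl
  remainingIndex-punchIn         (suc j) zero     = refl
  remainingIndex-punchIn {suc n} (suc j) (suc j′) = cong suc (remainingIndex-punchIn j j′)

  -- Removing columns j and c in either order leaves the same columns.
  punchIn-swap : ∀ {n} (j c : Fin (suc (suc n))) → j ≢ c → ∀ (b : Fin n) →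
    punchIn j (punchIn (remainingIndex j c) b) ≡ punchIn c (punchIn (remainingIndex c j) b)
  punchIn-swap         zero    zero    j≢c b       = ⊥-elim (j≢c refl)
  punchIn-swap         zero    (suc c) j≢c b       = refl
  punchIn-swap         (suc j) zero    j≢c b       = refl
  punchIn-swap {suc n} (suc j) (suc c) j≢c zero    = refl
  punchIn-swap {suc n} (suc j) (suc c) j≢c (suc b) = cong suc (punchIn-swap j c (j≢c ∘ cong suc) b)

  remainingIndex-< : ∀ {n} (j c : Fin (suc (suc n))) → toℕ j < toℕ c → suc (toℕ (remainingIndex j c)) ≡ toℕ c
  remainingIndex-<         zero          (suc c)       lt       = refl
  remainingIndex-< {zero}  (suc zero)    (suc zero)    (s≤s ())
  remainingIndex-< {suc n} (suc j)       (suc c)       (s≤s lt) = cong suc (remainingIndex-< j c lt)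

  remainingIndex-> : ∀ {n} (j c : Fin (suc (suc n))) → toℕ c < toℕ j → toℕ (remainingIndex j c) ≡ toℕ c
  remainingIndex->         (suc j)       zero          lt       = refl
  remainingIndex-> {zero}  (suc zero)    (suc zero)    (s≤s ())
  remainingIndex-> {suc n} (suc j)       (suc c)       (s≤s lt) = cong suc (remainingIndex-> j c lt)

  self-negating : ∀ S → S ≡ - S → S ≡ 0ℚ
  self-negating S e = ι-suc-cancel 1 S (trans (solve 1 (λ s → (con 1ℚ :+ (con 1ℚ :+ con 0ℚ)) :* s := s :+ s) refl S)
    (trans (cong (λ t → S + t) e) (+-inverseʳ S)))

  -- Rows 0 and 1 equal: expanding along both rows gives a double sum over pairs of
  -- distinct columns (j, c) whose terms are antisymmetric in (j, c).
  module FirstTwoRowsEqual (n : ℕ) (M : Mat (suc (suc n))) (e01 : ∀ b → M zero b ≈ M (suc zero) b) (m : ℕ) where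
    r : Fin (suc (suc n)) → PS
    r = M zero

    -- the complementary minor once columns j and (the c-th remaining) c are removed
    Q : Fin (suc (suc n)) → Fin (suc n) → PS
    Q j c = det n (λ a b → M (suc (suc a)) (punchIn j (punchIn c b)))

    U : Fin (suc (suc n)) → Fin (suc (suc n)) → ℚ
    U j c = sg (toℕ j) (sg (toℕ (remainingIndex j c)) ((r j ⊛ (r c ⊛ Q j (remainingIndex j c))) m))

    T : Fin (suc (suc n)) → Fin (suc (suc n)) → ℚ
    T j c with j FinP.≟ c
    ... | yes _ = 0ℚ
    ... | no  _ = U j c

    U-antisym : ∀ j c → toℕ j < toℕ c → U c j ≡ - U j c
    U-antisym j c lt = begin
      U c j
        ≡⟨ sg-add (toℕ c) (toℕ (remainingIndex c j)) _ ⟩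
      sg (toℕ c ℕ.+ toℕ (remainingIndex c j)) ((r c ⊛ (r j ⊛ Q c (remainingIndex c j))) m)
        ≡⟨ cong₂ sg exponent (trans (⊛-lcomm (r c) (r j) (Q c (remainingIndex c j)) m)
                                    (⊛-congʳ (r j) (⊛-congʳ (r c) same-minor) m)) ⟩
      sg (suc (toℕ j ℕ.+ toℕ (remainingIndex j c))) ((r j ⊛ (r c ⊛ Q j (remainingIndex j c))) m)
        ≡⟨ sg-suc (toℕ j ℕ.+ toℕ (remainingIndex j c)) _ ⟩
      - sg (toℕ j ℕ.+ toℕ (remainingIndex j c)) ((r j ⊛ (r c ⊛ Q j (remainingIndex j c))) m)
        ≡⟨ cong -_ (sym (sg-add (toℕ j) (toℕ (remainingIndex j c)) _)) ⟩
      - U j c ∎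
      where
      open ≡-Reasoning
      j≢c : j ≢ c
      j≢c refl = ℕP.<-irrefl refl lt
      exponent : toℕ c ℕ.+ toℕ (remainingIndex c j) ≡ suc (toℕ j ℕ.+ toℕ (remainingIndex j c))
      exponent = trans (cong₂ ℕ._+_ (sym (remainingIndex-< j c lt)) (remainingIndex-> c j lt))
                       (cong suc (ℕP.+-comm (toℕ (remainingIndex j c)) (toℕ j)))
      same-minor : Q c (remainingIndex c j) ≈ Q j (remainingIndex j c)
      same-minor = det-cong n _ _ (λ a b k → cong (λ z → M (suc (suc a)) z k) (sym (punchIn-swap j c j≢c b)))

    T-antisym : ∀ j c → T c j ≡ - T j c
    T-antisym j c with j FinP.≟ c | c FinP.≟ j
    ... | yes refl | yes _    = refl
    ... | yes refl | no  c≢j  = ⊥-elim (c≢j refl)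
    ... | no  j≢c  | yes refl = ⊥-elim (j≢c refl)
    ... | no  j≢c  | no  c≢j  with ℕP.<-cmp (toℕ j) (toℕ c)
    ...   | tri< lt _ _ = U-antisym j c lt
    ...   | tri≈ _ eq _ = ⊥-elim (j≢c (FinP.toℕ-injective eq))
    ...   | tri> _ _ gt = trans (sym (neg-involutive (U c j))) (cong -_ (sym (U-antisym c j gt)))

    T-diagonal : ∀ j → T j j ≡ 0ℚ
    T-diagonal j with j FinP.≟ j
    ... | yes _ = refl
    ... | no ne = ⊥-elim (ne refl)

    T-off-diagonal : ∀ j c → j ≢ c → T j c ≡ U j c
    T-off-diagonal j c ne with j FinP.≟ c
    ... | yes eq = ⊥-elim (ne eq)
    ... | no _   = refl

    -- The minor at column j, expanded along its first row (a copy of row 0).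
    minor-expand : ∀ j → det (suc n) (minor M j) ≈ (λ k → sum (λ j′ → sg (toℕ j′) ((r (punchIn j j′) ⊛ Q j j′) k)))
    minor-expand j k = trans (det-expand n (minor M j) k) (sum-cong-≗ (λ j′ → cong (sg (toℕ j′))
      (⊛-cong {minor M j zero j′} {r (punchIn j j′)}
         (λ k′ → trans (cong (λ z → z k′) (removeAt-punchIn (M (suc zero)) j j′)) (sym (e01 (punchIn j j′) k′)))
         (det-cong n _ _ (λ a b k′ → cong (λ z → z k′) (trans (removeAt-punchIn (λ b → removeAt (M (suc (suc a))) j b) j′ b)
                                                                (removeAt-punchIn (M (suc (suc a))) j (punchIn j′ b))))) k)))

    row-term : ∀ j → sg (toℕ j) ((r j ⊛ det (suc n) (minor M j)) m) ≡ sum (T j)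
    row-term j = begin
      sg (toℕ j) ((r j ⊛ det (suc n) (minor M j)) m)
        ≡⟨ cong (sg (toℕ j)) (trans (⊛-congʳ (r j) (minor-expand j) m)
             (trans (⊛-ΣPSʳ (r j) (λ j′ k → sg (toℕ j′) ((r (punchIn j j′) ⊛ Q j j′) k)) m)
                    (sum-cong-≗ (λ j′ → ⊛-sgʳ (toℕ j′) (r j) (r (punchIn j j′) ⊛ Q j j′) m)))) ⟩
      sg (toℕ j) (sum (λ j′ → sg (toℕ j′) ((r j ⊛ (r (punchIn j j′) ⊛ Q j j′)) m)))
        ≡⟨ sym (sum-sg (toℕ j) (λ j′ → sg (toℕ j′) ((r j ⊛ (r (punchIn j j′) ⊛ Q j j′)) m))) ⟩
      sum (λ j′ → sg (toℕ j) (sg (toℕ j′) ((r j ⊛ (r (punchIn j j′) ⊛ Q j j′)) m)))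
        ≡⟨ sum-cong-≗ (λ j′ → trans (cong (λ z → sg (toℕ j) (sg (toℕ z) ((r j ⊛ (r (punchIn j j′) ⊛ Q j z)) m)))
                                          (sym (remainingIndex-punchIn j j′)))
                                    (sym (T-off-diagonal j (punchIn j j′) (λ eq → FinP.punchInᵢ≢i j j′ (sym eq))))) ⟩
      sum (λ j′ → T j (punchIn j j′))
        ≡⟨ sym (trans (sum-remove {i = j} (T j)) (trans (cong (_+ sum (λ j′ → T j (punchIn j j′))) (T-diagonal j)) (+-identityˡ _))) ⟩
      sum (T j) ∎
      where open ≡-Reasoning

    S : ℚ
    S = sum (λ j → sum (T j))

    S-antisym : S ≡ - S
    S-antisym = begin
      S                                   ≡⟨ ∑-comm T ⟩
      sum (λ c → sum (λ j → T j c))       ≡⟨ sum-cong-≗ (λ c → sum-cong-≗ (λ j → T-antisym c j)) ⟩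
      sum (λ c → sum (λ j → - T c j))     ≡⟨ sum-cong-≗ (λ c → sum-neg (T c)) ⟩
      sum (λ c → - sum (T c))             ≡⟨ sum-neg (λ c → sum (T c)) ⟩
      - S                                 ∎
      where open ≡-Reasoning

    vanishes : det (suc (suc n)) M m ≡ 0ℚ
    vanishes = trans (det-expand (suc n) M m) (trans (sum-cong-≗ row-term) (self-negating S S-antisym))

  det-equal-adjacent-rows : ∀ n (M : Mat (suc (suc n))) (k : Fin (suc n)) →
    (∀ b → M (inject₁ k) b ≈ M (suc k) b) → det (suc (suc n)) M ≈ zeroPS
  det-equal-adjacent-rows n M zero e m = FirstTwoRowsEqual.vanishes n M e m
  det-equal-adjacent-rows (suc n) M (suc k) e m = trans (det-expand (suc (suc n)) M m) (sum-0 _ (λ j →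
    trans (cong (sg (toℕ j)) (trans (⊛-congʳ (M zero j) (det-equal-adjacent-rows n (minor M j) k (minor-rows j)) m)
                                    (⊛-zeroʳ (M zero j) m)))
          (sg-0 (toℕ j))))
    where
    minor-rows : ∀ j b → minor M j (inject₁ k) b ≈ minor M j (suc k) b
    minor-rows j b k′ = trans (cong (λ z → z k′) (removeAt-punchIn (M (suc (inject₁ k))) j b))
      (trans (e (punchIn j b) k′) (cong (λ z → z k′) (sym (removeAt-punchIn (M (suc (suc k))) j b))))

module Bessel where

  open import Data.Fin using (Fin; toℕ; fromℕ<)
  import Data.Fin.Properties as FinP
  open import Relation.Nullary using (_×-dec_)
  open import Relation.Nullary.Decidable using (map′)
  open import Algebra.Properties.Group (AbelianGroup.group ℤP.+-0-abelianGroup) using (∙-cancelʳ)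
  open Embedding
  open FiniteSums
  open Series

  ind-yes : ∀ {P : Set} (d : Dec P) q → P → ind d q ≡ q
  ind-yes (yes _) q p = refl
  ind-yes (no ¬p) q p = ⊥-elim (¬p p)

  ind-no : ∀ {P : Set} (d : Dec P) q → ¬ P → ind d q ≡ 0ℚ
  ind-no (yes p) q ¬p = ⊥-elim (¬p p)
  ind-no (no _)  q ¬p = refl

  ind-when : ∀ {P : Set} (p : Dec P) x → (¬ P → x ≡ 0ℚ) → ind p x ≡ x
  ind-when (yes _) x h = refl
  ind-when (no np) x h = sym (h np)

  -- Split s j: j = u + v and s = u − v for some naturals u, v; exactly then the
  -- coefficient of x^j in I_s(2x) is nonzero (namely 1 / (v! u!)).
  Split : ℤ → ℕ → Set
  Split s j = Σ ℕ λ u → Σ ℕ λ v → (u ℕ.+ v ≡ j) × (+ u ℤ.- + v ≡ s)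

  Split? : ∀ s j → Dec (Split s j)
  Split? s j = map′ from-index to-index (FinP.any? (λ (u : Fin (suc j)) → + toℕ u ℤ.- + (j ∸ toℕ u) ℤ.≟ s))
    where
    from-index : (Σ (Fin (suc j)) λ u → + toℕ u ℤ.- + (j ∸ toℕ u) ≡ s) → Split s j
    from-index (u , e) = toℕ u , j ∸ toℕ u , ℕP.m+[n∸m]≡n (FinP.toℕ≤pred[n] u) , e
    to-index : Split s j → Σ (Fin (suc j)) λ u → + toℕ u ℤ.- + (j ∸ toℕ u) ≡ s
    to-index (u , v , uv , e) = fromℕ< (s≤s u≤j) ,
      subst (λ t → + t ℤ.- + (j ∸ t) ≡ s) (sym (FinP.toℕ-fromℕ< (s≤s u≤j)))
            (subst (λ t → + u ℤ.- + t ≡ s) (sym (trans (cong (_∸ u) (sym uv)) (ℕP.m+n∸m≡n u v))) e)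
      where
      u≤j : u ≤ j
      u≤j = subst (u ≤_) uv (ℕP.m≤m+n u v)

  -- The coefficient of x^{u+v} in I_{u−v}(2x) is 1 / (v! u!) (only n = v contributes) …
  besselI2x-split : ∀ u v → besselI2x (+ u ℤ.- + v) (u ℕ.+ v) ≡ invFacts v u
  besselI2x-split u v = trans (Σ≤-as-Σ< (u ℕ.+ v ℕ.+ ∣ s ∣) term)
    (trans (Σ<-single (suc (u ℕ.+ v ℕ.+ ∣ s ∣)) {term} v v<
             (λ n _ n≢v → ind-no (dec n) (val n) (λ { (_ , e) → n≢v (unique n e) })))
      (trans (ind-yes (dec v) (val v) (ℤP.≤-trans (ℤ.+≤+ z≤n) (ℤP.≤-reflexive (sym v+s≡u)) , 2v+s≡u+v))
             (cong (invFacts v) (cong ∣_∣ v+s≡u))))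
    where
    s : ℤ
    s = + u ℤ.- + v
    dec : ∀ n → Dec ((+ 0 ℤ.≤ + n ℤ.+ s) × ((+ (2 ℕ.* n)) ℤ.+ s ≡ + (u ℕ.+ v)))
    dec n = (+ 0 ℤ.≤? + n ℤ.+ s) ×-dec ((+ (2 ℕ.* n)) ℤ.+ s ℤ.≟ + (u ℕ.+ v))
    val term : ℕ → ℚ
    val n = invFacts n ∣ + n ℤ.+ s ∣
    term n = ind (dec n) (val n)
    v+s≡u : + v ℤ.+ s ≡ + u
    v+s≡u = ℤS.solve 2 (λ u v → v ℤS.:+ (u ℤS.:- v) ℤS.:= u) refl (+ u) (+ v)
    2v+s≡u+v : + (2 ℕ.* v) ℤ.+ s ≡ + (u ℕ.+ v)
    2v+s≡u+v = trans (cong (ℤ._+ s) (ℤP.pos-* 2 v)) (trans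
      (ℤS.solve 2 (λ u v → (ℤS.con (+ 2) ℤS.:* v) ℤS.:+ (u ℤS.:- v) ℤS.:= u ℤS.:+ v) refl (+ u) (+ v))
      (sym (ℤP.pos-+ u v)))
    v< : v < suc (u ℕ.+ v ℕ.+ ∣ s ∣)
    v< = s≤s (ℕP.≤-trans (ℕP.m≤n+m v u) (ℕP.m≤m+n (u ℕ.+ v) ∣ s ∣))
    unique : ∀ n → + (2 ℕ.* n) ℤ.+ s ≡ + (u ℕ.+ v) → n ≡ v
    unique n e = ℕP.*-cancelˡ-≡ n v 2 (ℤP.+-injective (∙-cancelʳ s (+ (2 ℕ.* n)) (+ (2 ℕ.* v)) (trans e (sym 2v+s≡u+v))))

  besselI2x-no-split : ∀ s j → ¬ Split s j → besselI2x s j ≡ 0ℚ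
  besselI2x-no-split s j ns = trans (Σ≤-as-Σ< (j ℕ.+ ∣ s ∣) term)
    (Σ<-zero (suc (j ℕ.+ ∣ s ∣)) (λ n _ → ind-no (dec n) (val n) (λ { (p , e) → ns (split n p e) })))
    where
    dec : ∀ n → Dec ((+ 0 ℤ.≤ + n ℤ.+ s) × ((+ (2 ℕ.* n)) ℤ.+ s ≡ + j))
    dec n = (+ 0 ℤ.≤? + n ℤ.+ s) ×-dec ((+ (2 ℕ.* n)) ℤ.+ s ℤ.≟ + j)
    val term : ℕ → ℚ
    val n = invFacts n ∣ + n ℤ.+ s ∣
    term n = ind (dec n) (val n)
    split : ∀ n → + 0 ℤ.≤ + n ℤ.+ s → + (2 ℕ.* n) ℤ.+ s ≡ + j → Split s j
    split n p e = ∣ + n ℤ.+ s ∣ , n ,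
      ℤP.+-injective (trans (ℤP.pos-+ ∣ + n ℤ.+ s ∣ n) (trans (cong (ℤ._+ + n) a≡)
        (trans (trans (ℤS.solve 2 (λ n s → (n ℤS.:+ s) ℤS.:+ n ℤS.:= (ℤS.con (+ 2) ℤS.:* n) ℤS.:+ s) refl (+ n) s)
                      (cong (ℤ._+ s) (sym (ℤP.pos-* 2 n)))) e))) ,
      trans (cong (ℤ._- + n) a≡) (ℤS.solve 2 (λ n s → (n ℤS.:+ s) ℤS.:- n ℤS.:= s) refl (+ n) s)
      where
      a≡ : + ∣ + n ℤ.+ s ∣ ≡ + n ℤ.+ s
      a≡ = ℤP.0≤i⇒+∣i∣≡i p

  besselI2x-at-split : ∀ s j u v → u ℕ.+ v ≡ j → + u ℤ.- + v ≡ s → besselI2x s j ≡ invFacts v u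
  besselI2x-at-split s j u v refl refl = besselI2x-split u v

  invFacts-comm : ∀ a b → invFacts a b ≡ invFacts b a
  invFacts-comm a b = /-unique 1 (a ! ℕ.* b !) {{a !* b !≢0}} (invFacts b a)
    (sym (trans (cong (λ t → ι t * invFacts b a) (ℕP.*-comm (a !) (b !)))
                (trans (*-comm (ι (b ! ℕ.* a !)) (invFacts b a)) (/-*-ι 1 (b ! ℕ.* a !) {{b !* a !≢0}}))))

  invFacts-suc : ∀ u v → ι (suc u) * invFacts v (suc u) ≡ invFacts v u
  invFacts-suc u v = sym (/-unique 1 (v ! ℕ.* u !) {{v !* u !≢0}} (ι (suc u) * i′) (begin
    ι 1
      ≡⟨ sym (/-*-ι 1 (v ! ℕ.* suc u !) {{v !* suc u !≢0}}) ⟩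
    i′ * ι (v ! ℕ.* (suc u ℕ.* u !))
      ≡⟨ cong (i′ *_) (trans (ι-* (v !) (suc u ℕ.* u !)) (cong (ι (v !) *_) (ι-* (suc u) (u !)))) ⟩
    i′ * (ι (v !) * (ι (suc u) * ι (u !)))
      ≡⟨ solve 4 (λ i a b c → i :* (a :* (b :* c)) := (a :* c) :* (b :* i)) refl i′ (ι (v !)) (ι (suc u)) (ι (u !)) ⟩
    (ι (v !) * ι (u !)) * (ι (suc u) * i′)
      ≡⟨ cong (_* (ι (suc u) * i′)) (sym (ι-* (v !) (u !))) ⟩
    ι (v ! ℕ.* u !) * (ι (suc u) * i′) ∎))
    where
    open ≡-Reasoning
    i′ : ℚ
    i′ = invFacts v (suc u)

  -- Symmetry I_{−s} = I_s (swap the roles of u and v).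
  besselI2x-neg : ∀ s j → besselI2x (ℤ.- s) j ≡ besselI2x s j
  besselI2x-neg s j with Split? s j
  ... | yes (u , v , uv , e) =
    trans (besselI2x-at-split (ℤ.- s) j v u (trans (ℕP.+-comm v u) uv) swapped)
          (trans (invFacts-comm u v) (sym (besselI2x-at-split s j u v uv e)))
    where
    swapped : + v ℤ.- + u ≡ ℤ.- s
    swapped = trans (ℤS.solve 2 (λ u v → v ℤS.:- u ℤS.:= ℤS.:- (u ℤS.:- v)) refl (+ u) (+ v)) (cong ℤ.-_ e)
  ... | no ns = trans (besselI2x-no-split (ℤ.- s) j ns′) (sym (besselI2x-no-split s j ns))
    where
    ns′ : ¬ Split (ℤ.- s) j
    ns′ (u , v , uv , e) = ns (v , u , trans (ℕP.+-comm v u) uv ,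
      trans (ℤS.solve 2 (λ u v → v ℤS.:- u ℤS.:= ℤS.:- (u ℤS.:- v)) refl (+ u) (+ v)) (trans (cong ℤ.-_ e) (ℤP.neg-involutive s)))

  besselI2x-0-at-0 : besselI2x (+ 0) 0 ≡ 1ℚ
  besselI2x-0-at-0 = besselI2x-split 0 0

  besselI2x-at-0 : ∀ s → s ≢ + 0 → besselI2x s 0 ≡ 0ℚ
  besselI2x-at-0 s ne = besselI2x-no-split s 0 (λ { (zero , zero , _ , e) → ne (sym e) })

  -- The split of s at length j is unique: 2u = j + s.
  Split-unique : ∀ {s j} (p q : Split s j) → proj₁ p ≡ proj₁ q
  Split-unique {s} {j} (u , v , uv , e) (u′ , v′ , uv′ , e′) =
    ℕP.*-cancelˡ-≡ u u′ 2 (ℤP.+-injective (trans (twice u v uv e) (sym (twice u′ v′ uv′ e′))))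
    where
    twice : ∀ u v → u ℕ.+ v ≡ j → + u ℤ.- + v ≡ s → + (2 ℕ.* u) ≡ s ℤ.+ + j
    twice u v uv e = trans (ℤP.pos-* 2 u) (trans
      (ℤS.solve 2 (λ u v → ℤS.con (+ 2) ℤS.:* u ℤS.:= (u ℤS.:- v) ℤS.:+ (u ℤS.:+ v)) refl (+ u) (+ v))
      (cong₂ ℤ._+_ e (cong +_ uv)))

  Split-pred : ∀ s k → Split (s ℤ.- + 1) k → Split s (suc k)
  Split-pred s k (u , v , uv , e) = suc u , v , cong suc uv ,
    trans (ℤS.solve 2 (λ u v → (ℤS.con (+ 1) ℤS.:+ u) ℤS.:- v ℤS.:= (u ℤS.:- v) ℤS.:+ ℤS.con (+ 1)) refl (+ u) (+ v))
          (trans (cong (ℤ._+ + 1) e) (ℤS.solve 1 (λ s → (s ℤS.:- ℤS.con (+ 1)) ℤS.:+ ℤS.con (+ 1) ℤS.:= s) refl s))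

  Split-suc : ∀ s k → Split (s ℤ.+ + 1) k → Split s (suc k)
  Split-suc s k (u , v , uv , e) = u , suc v , trans (ℕP.+-suc u v) (cong suc uv) ,
    trans (ℤS.solve 2 (λ u v → u ℤS.:- (ℤS.con (+ 1) ℤS.:+ v) ℤS.:= (u ℤS.:- v) ℤS.:- ℤS.con (+ 1)) refl (+ u) (+ v))
          (trans (cong (ℤ._- + 1) e) (ℤS.solve 1 (λ s → (s ℤS.:+ ℤS.con (+ 1)) ℤS.:- ℤS.con (+ 1) ℤS.:= s) refl s))

  recurrence-down-at-split : ∀ s k u v → suc u ℕ.+ v ≡ suc k → + suc u ℤ.- + v ≡ s →
    E ½ (ιℤ s) (besselI2x s) (suc k) ≡ invFacts v u
  recurrence-down-at-split s k u v uv e = begin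
    ½ * (ι (suc k) + ιℤ s) * besselI2x s (suc k)
      ≡⟨ cong₂ (λ a b → ½ * (ι a + b) * besselI2x s (suc k)) (sym uv) (trans (cong ιℤ (sym e)) (ιℤ-- (+ suc u) (+ v))) ⟩
    ½ * (ι (suc u ℕ.+ v) + (ι (suc u) - ι v)) * besselI2x s (suc k)
      ≡⟨ cong (λ a → ½ * (a + (ι (suc u) - ι v)) * besselI2x s (suc k)) (ι-+ (suc u) v) ⟩
    ½ * ((ι (suc u) + ι v) + (ι (suc u) - ι v)) * besselI2x s (suc k)
      ≡⟨ solve 3 (λ a b i → con ½ :* ((a :+ b) :+ (a :- b)) :* i := a :* i) refl (ι (suc u)) (ι v) (besselI2x s (suc k)) ⟩
    ι (suc u) * besselI2x s (suc k)
      ≡⟨ cong (ι (suc u) *_) (besselI2x-at-split s (suc k) (suc u) v uv e) ⟩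
    ι (suc u) * invFacts v (suc u)
      ≡⟨ invFacts-suc u v ⟩
    invFacts v u ∎
    where open ≡-Reasoning

  recurrence-down : ∀ s k → X (besselI2x (s ℤ.- + 1)) k ≡ E ½ (ιℤ s) (besselI2x s) k
  recurrence-down s zero with s ℤ.≟ + 0
  ... | yes refl = sym (solve 1 (λ i → con ½ :* (con 0ℚ :+ con 0ℚ) :* i := con 0ℚ) refl (besselI2x (+ 0) 0))
  ... | no ne    = sym (trans (cong (½ * (ι 0 + ιℤ s) *_) (besselI2x-at-0 s ne)) (*-zeroʳ (½ * (ι 0 + ιℤ s))))
  recurrence-down s (suc k) with Split? s (suc k)
  -- no split of s: neither side has a term
  ... | no ns = trans (besselI2x-no-split (s ℤ.- + 1) k (ns ∘ Split-pred s k))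
    (sym (trans (cong (½ * (ι (suc k) + ιℤ s) *_) (besselI2x-no-split s (suc k) ns)) (*-zeroʳ (½ * (ι (suc k) + ιℤ s)))))
  -- s = −(k + 1): s − 1 has no split at length k, and the factor θ + s vanishes
  ... | yes (zero , .(suc k) , refl , e) =
    trans (besselI2x-no-split (s ℤ.- + 1) k (λ sp → ℕP.0≢1+n (Split-unique (zero , suc k , refl , e) (Split-pred s k sp))))
    (sym (trans (cong (λ z → ½ * (ι (suc k) + z) * besselI2x s (suc k)) (trans (cong ιℤ (sym e)) (ιℤ-- (+ 0) (+ suc k))))
                (solve 2 (λ a i → con ½ :* (a :+ (con 0ℚ :- a)) :* i := con 0ℚ) refl (ι (suc k)) (besselI2x s (suc k)))))
  -- the split (u + 1, v) of s comes from the split (u, v) of s − 1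
  ... | yes (suc u , v , uv , e) = trans (besselI2x-at-split (s ℤ.- + 1) k u v (ℕP.suc-injective uv)
      (trans (ℤS.solve 2 (λ u v → u ℤS.:- v ℤS.:= ((ℤS.con (+ 1) ℤS.:+ u) ℤS.:- v) ℤS.:- ℤS.con (+ 1)) refl (+ u) (+ v)) (cong (ℤ._- + 1) e)))
    (sym (recurrence-down-at-split s k u v uv e))

  -- x I_{s+1}(2x) = ½ (θ − s) I_s(2x), from the previous recurrence and I_{−s} = I_s.
  recurrence-up : ∀ s k → X (besselI2x (s ℤ.+ + 1)) k ≡ E ½ (- ιℤ s) (besselI2x s) k
  recurrence-up s k = begin
    X (besselI2x (s ℤ.+ + 1)) k              ≡⟨ X-cong reflect k ⟩
    X (besselI2x (ℤ.- s ℤ.- + 1)) k          ≡⟨ recurrence-down (ℤ.- s) k ⟩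
    E ½ (ιℤ (ℤ.- s)) (besselI2x (ℤ.- s)) k   ≡⟨ cong₂ (λ t y → ½ * (ι k + t) * y) (ιℤ-neg s) (besselI2x-neg s k) ⟩
    E ½ (- ιℤ s) (besselI2x s) k             ∎
    where
    open ≡-Reasoning
    reflect : besselI2x (s ℤ.+ + 1) ≈ besselI2x (ℤ.- s ℤ.- + 1)
    reflect j = trans (sym (besselI2x-neg (s ℤ.+ + 1) j))
      (cong (λ t → besselI2x t j) (ℤS.solve 1 (λ s → ℤS.:- (s ℤS.:+ ℤS.con (+ 1)) ℤS.:= ℤS.:- s ℤS.:- ℤS.con (+ 1)) refl s))

module InitialValues where

  open import Data.Fin using (zero; suc; toℕ)
  open import Data.Vec using ([]; _∷_; lookup)
  open import Relation.Binary using (Tri; tri<; tri≈; tri>)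
  open Series
  open Determinants
  open Bessel

  besselMatrix : ∀ {n} → Vec ℤ n → Vec ℤ n → Mat n
  besselMatrix ν μ i j = besselI2x (lookup ν i ℤ.- lookup μ j)

  det-at-0 : ∀ n (M : Mat (suc n)) →
    det (suc n) M 0 ≡ sum (λ j → sg (toℕ j) (M zero j 0 * det n (minor M j) 0))
  det-at-0 n M = trans (det-expand n M 0) (sum-cong-≗ (λ j → cong (sg (toℕ j)) (⊛-at-0 (M zero j) (det n (minor M j)))))

  det-at-0-zero-row : ∀ n (M : Mat (suc n)) → (∀ j → M zero j 0 ≡ 0ℚ) → det (suc n) M 0 ≡ 0ℚ
  det-at-0-zero-row n M h = trans (det-at-0 n M) (sum-0 _ (λ j →
    trans (cong (λ t → sg (toℕ j) (t * det n (minor M j) 0)) (h j))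
          (trans (cong (sg (toℕ j)) (*-zeroˡ (det n (minor M j) 0))) (sg-0 (toℕ j)))))

  det-at-0-zero-column : ∀ n (M : Mat (suc n)) → (∀ a → M a zero 0 ≡ 0ℚ) → det (suc n) M 0 ≡ 0ℚ
  det-at-0-zero-column n M h = trans (det-at-0 n M) (sum-0 _ (λ j → trans (cong (sg (toℕ j)) (term n M h j)) (sg-0 (toℕ j))))
    where
    -- the first-column entry vanishes, and every other minor keeps a zero column
    term : ∀ n (M : Mat (suc n)) → (∀ a → M a zero 0 ≡ 0ℚ) → ∀ j → M zero j 0 * det n (minor M j) 0 ≡ 0ℚ
    term n        M h zero    = trans (cong (_* det n (minor M zero) 0) (h zero)) (*-zeroˡ (det n (minor M zero) 0))
    term (suc n′) M h (suc j) =
      trans (cong (M zero (suc j) 0 *_) (det-at-0-zero-column n′ (minor M (suc j)) (λ a → h (suc a)))) (*-zeroʳ (M zero (suc j) 0))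

  det-at-0-pivot : ∀ n (M : Mat (suc n)) → (∀ j → M zero (suc j) 0 ≡ 0ℚ) →
    det (suc n) M 0 ≡ M zero zero 0 * det n (minor M zero) 0
  det-at-0-pivot n M h = trans (det-at-0 n M) (trans (cong (λ t → M zero zero 0 * det n (minor M zero) 0 + t)
    (sum-0 _ (λ j → trans (cong (λ t → sg (toℕ (suc j)) (t * det n (minor M (suc j)) 0)) (h j))
                          (trans (cong (sg (suc (toℕ j))) (*-zeroˡ (det n (minor M (suc j)) 0))) (sg-0 (suc (toℕ j)))))))
    (+-identityʳ _))

  I-at-0-≢ : ∀ a b → a ≢ b → besselI2x (a ℤ.- b) 0 ≡ 0ℚ
  I-at-0-≢ a b ne = besselI2x-at-0 (a ℤ.- b) (λ e → ne (trans (ℤS.solve 2 (λ a b → a ℤS.:= (a ℤS.:- b) ℤS.:+ b) refl a b)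
    (trans (cong (ℤ._+ b) e) (ℤP.+-identityˡ b))))

  I-at-0-≡ : ∀ a → besselI2x (a ℤ.- a) 0 ≡ 1ℚ
  I-at-0-≡ a = trans (cong (λ t → besselI2x t 0) (ℤP.+-inverseʳ a)) besselI2x-0-at-0

  head-bounds-tail : ∀ {n} y (ys : Vec ℤ n) → StrictDec (y ∷ ys) → ∀ j → lookup ys j ℤ.< y
  head-bounds-tail y (z ∷ zs) (z<y , _)  zero    = z<y
  head-bounds-tail y (z ∷ zs) (z<y , sd) (suc j) = ℤP.<-trans (head-bounds-tail z zs sd j) z<y

  head-bounds : ∀ {n} y (ys : Vec ℤ n) → StrictDec (y ∷ ys) → ∀ j → lookup (y ∷ ys) j ℤ.≤ y
  head-bounds y ys sd zero    = ℤP.≤-refl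
  head-bounds y ys sd (suc j) = ℤP.<⇒≤ (head-bounds-tail y ys sd j)

  StrictDec-tail : ∀ {n} y (ys : Vec ℤ n) → StrictDec (y ∷ ys) → StrictDec ys
  StrictDec-tail y []       _        = _
  StrictDec-tail y (z ∷ zs) (_ , sd) = sd

  besselDet-at-0-diagonal : ∀ n (ν : Vec ℤ n) → StrictDec ν → det n (besselMatrix ν ν) 0 ≡ 1ℚ
  besselDet-at-0-diagonal zero    []       _  = refl
  besselDet-at-0-diagonal (suc n) (x ∷ xs) sd =
    trans (det-at-0-pivot n (besselMatrix (x ∷ xs) (x ∷ xs))
            (λ j → I-at-0-≢ x (lookup xs j) (λ eq → ℤP.<-irrefl (sym eq) (head-bounds-tail x xs sd j))))
          (trans (cong₂ _*_ (I-at-0-≡ x) (besselDet-at-0-diagonal n xs (StrictDec-tail x xs sd))) (*-identityˡ 1ℚ))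

  -- F_ν(0) = 0 for ν ≠ μ.  Compare the first entries: if ν₁ < μ₁ the first column
  -- vanishes at 0, if ν₁ > μ₁ the first row does, and if ν₁ = μ₁ recurse.
  besselDet-at-0-off-diagonal : ∀ n (ν μ : Vec ℤ n) → StrictDec ν → StrictDec μ → ν ≢ μ →
    det n (besselMatrix ν μ) 0 ≡ 0ℚ
  besselDet-at-0-off-diagonal zero    []       []       _   _   ne = ⊥-elim (ne refl)
  besselDet-at-0-off-diagonal (suc n) (x ∷ xs) (y ∷ ys) sdν sdμ ne = by-heads (ℤP.<-cmp x y)
    where
    M : Mat (suc n)
    M = besselMatrix (x ∷ xs) (y ∷ ys)
    by-heads : Tri (x ℤ.< y) (x ≡ y) (y ℤ.< x) → det (suc n) M 0 ≡ 0ℚ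
    by-heads (tri< x<y _ _) = det-at-0-zero-column n M (λ a → I-at-0-≢ (lookup (x ∷ xs) a) y
      (λ eq → ℤP.<-irrefl eq (ℤP.≤-<-trans (head-bounds x xs sdν a) x<y)))
    by-heads (tri> _ _ y<x) = det-at-0-zero-row n M (λ j → I-at-0-≢ x (lookup (y ∷ ys) j)
      (λ eq → ℤP.<-irrefl (sym eq) (ℤP.≤-<-trans (head-bounds y ys sdμ j) y<x)))
    by-heads (tri≈ _ refl _) = trans (det-at-0-pivot n M
        (λ j → I-at-0-≢ x (lookup ys j) (λ eq → ℤP.<-irrefl (sym eq) (head-bounds-tail x ys sdμ j))))
      (trans (cong₂ _*_ (I-at-0-≡ x) (besselDet-at-0-off-diagonal n xs ys (StrictDec-tail x xs sdν) (StrictDec-tail x ys sdμ) (ne ∘ cong (x ∷_))))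
             (*-zeroʳ 1ℚ))

module NeighbourSums {d : ℕ} (μ : Vec ℤ d) where

  open import Data.Fin using (Fin; zero; suc)
  open import Data.Vec using (_∷_; lookup; updateAt)
  open Embedding
  open Series
  open Determinants
  open Bessel
  open InitialValues using (besselMatrix)

  F : Vec ℤ d → PS
  F ν = det d (besselMatrix ν μ)

  K : Vec ℤ d → ℚ
  K ν = sum (λ i → ιℤ (lookup ν i)) - sum (λ j → ιℤ (lookup μ j))

  lookup-updateAt : ∀ {n} (v : Vec ℤ n) i f a → lookup (updateAt v i f) a ≡ replaceRow (lookup v) i (f (lookup v i)) a
  lookup-updateAt (x ∷ xs) zero    f zero    = refl
  lookup-updateAt (x ∷ xs) zero    f (suc a) = refl
  lookup-updateAt (x ∷ xs) (suc i) f zero    = refl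
  lookup-updateAt (x ∷ xs) (suc i) f (suc a) = lookup-updateAt xs i f a

  besselMatrix-updateAt : ∀ ν i f a b →
    besselMatrix (updateAt ν i f) μ a b ≡ replaceRow (besselMatrix ν μ) i (λ b → besselI2x (f (lookup ν i) ℤ.- lookup μ b)) a b
  besselMatrix-updateAt ν i f a b = cong (λ t → t b)
    (trans (cong (λ x b → besselI2x (x ℤ.- lookup μ b)) (lookup-updateAt ν i f a))
           (replaceRow-map (λ x b → besselI2x (x ℤ.- lookup μ b)) (lookup ν) i (f (lookup ν i)) a))

  module UnitStep (f : ℤ → ℤ) (σ : ℚ → ℚ)
    (recurrence : ∀ x y k → X (besselI2x (f x ℤ.- y)) k ≡ E ½ (σ (ιℤ x) - σ (ιℤ y)) (besselI2x (x ℤ.- y)) k) where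

    shifted-row : ∀ ν i → X (F (updateAt ν i f))
      ≈ det d (replaceRow (besselMatrix ν μ) i (λ b → E ½ (σ (ιℤ (lookup ν i)) - σ (ιℤ (lookup μ b))) (besselMatrix ν μ i b)))
    shifted-row ν i k = begin
      X (F (updateAt ν i f)) k
        ≡⟨ X-cong (det-cong d _ _ (λ a b → ≡⇒≈ (besselMatrix-updateAt ν i f a b))) k ⟩
      X (det d (replaceRow M i r₀)) k
        ≡⟨ sym (det-X-row d (replaceRow M i r₀) i k) ⟩
      det d (replaceRow (replaceRow M i r₀) i (λ b → X (replaceRow M i r₀ i b))) k
        ≡⟨ det-cong d _ _ (λ a b → ≡⇒≈ (trans (cong (λ t → t b) (replaceRow-twice M i r₀ (λ b → X (replaceRow M i r₀ i b)) a))
                                              (replaceRow-cong M i _ _ (λ b → cong (λ t → X (t b)) (replaceRow-at M i r₀)) a b))) k ⟩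
      det d (replaceRow M i (λ b → X (r₀ b))) k
        ≡⟨ det-cong d _ _ (replaceRow-≈ M i _ _ (λ b → recurrence (lookup ν i) (lookup μ b))) k ⟩
      det d (replaceRow M i (λ b → E ½ (σ (ιℤ (lookup ν i)) - σ (ιℤ (lookup μ b))) (M i b))) k ∎
      where
      open ≡-Reasoning
      M : Mat d
      M = besselMatrix ν μ
      r₀ : Fin d → PS
      r₀ b = besselI2x (f (lookup ν i) ℤ.- lookup μ b)

    neighbour-sum : ∀ ν m → sum (λ i → F (updateAt ν i f) m)
      ≡ ½ * (ι (suc m) + (sum (λ i → σ (ιℤ (lookup ν i))) - sum (λ j → σ (ιℤ (lookup μ j))))) * F ν (suc m)
    neighbour-sum ν m = trans (sum-cong-≗ (λ i → shifted-row ν i (suc m)))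
      (det-E d (besselMatrix ν μ) ½ (λ i → σ (ιℤ (lookup ν i))) (λ j → σ (ιℤ (lookup μ j))) (suc m))

  recurrence-down′ : ∀ x y k → X (besselI2x ((x ℤ.- + 1) ℤ.- y)) k ≡ E ½ (ιℤ x - ιℤ y) (besselI2x (x ℤ.- y)) k
  recurrence-down′ x y k =
    trans (cong (λ t → X (besselI2x t) k) (ℤS.solve 2 (λ x y → (x ℤS.:- ℤS.con (+ 1)) ℤS.:- y ℤS.:= (x ℤS.:- y) ℤS.:- ℤS.con (+ 1)) refl x y))
          (trans (recurrence-down (x ℤ.- y) k) (cong (λ t → E ½ t (besselI2x (x ℤ.- y)) k) (ιℤ-- x y)))

  recurrence-up′ : ∀ x y k → X (besselI2x ((x ℤ.+ + 1) ℤ.- y)) k ≡ E ½ (- ιℤ x - - ιℤ y) (besselI2x (x ℤ.- y)) k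
  recurrence-up′ x y k =
    trans (cong (λ t → X (besselI2x t) k) (ℤS.solve 2 (λ x y → (x ℤS.:+ ℤS.con (+ 1)) ℤS.:- y ℤS.:= (x ℤS.:- y) ℤS.:+ ℤS.con (+ 1)) refl x y))
          (trans (recurrence-up (x ℤ.- y) k) (cong (λ t → E ½ t (besselI2x (x ℤ.- y)) k)
            (trans (cong -_ (ιℤ-- x y)) (solve 2 (λ a b → :- (a :- b) := (:- a) :- (:- b)) refl (ιℤ x) (ιℤ y)))))

  module Down = UnitStep (ℤ._- + 1) (λ x → x) recurrence-down′
  module Up   = UnitStep (ℤ._+ + 1) -_ recurrence-up′

  lower-neighbour-sum : ∀ ν m → sum (λ i → F (updateAt ν i (ℤ._- + 1)) m) ≡ ½ * (ι (suc m) + K ν) * F ν (suc m)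
  lower-neighbour-sum = Down.neighbour-sum

  upper-neighbour-sum : ∀ ν m → sum (λ i → F (updateAt ν i (ℤ._+ + 1)) m) ≡ ½ * (ι (suc m) - K ν) * F ν (suc m)
  upper-neighbour-sum ν m = trans (Up.neighbour-sum ν m) (cong (λ t → ½ * (ι (suc m) + t) * F ν (suc m))
    (trans (cong₂ _-_ (sum-neg (λ i → ιℤ (lookup ν i))) (sum-neg (λ j → ιℤ (lookup μ j))))
           (solve 2 (λ a b → (:- a) :- (:- b) := :- (a :- b)) refl (sum (λ i → ιℤ (lookup ν i))) (sum (λ j → ιℤ (lookup μ j))))))

module Counting {A : Set} (_≟_ : (x y : A) → Dec (x ≡ y)) where

  open import Data.List using (List; []; _∷_; _++_; filter; length; concatMap; map)
  import Data.List.Properties as ListP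
  open import Data.Nat.ListAction using () renaming (sum to sumℕ)
  open import Algebra.Properties.CommutativeSemigroup ℕP.+-commutativeSemigroup using (interchange)
  open import Relation.Unary using (Pred; Decidable)
  open import Level using (0ℓ)

  count : A → List A → ℕ
  count y xs = length (filter (λ v → v ≟ y) xs)

  indicator : ∀ {P : Set} → Dec P → ℕ
  indicator (yes _) = 1
  indicator (no _)  = 0

  indicator-⇔ : ∀ {P Q : Set} → (P → Q) → (Q → P) → (p : Dec P) (q : Dec Q) → indicator p ≡ indicator q
  indicator-⇔ f g (yes p) (yes q) = refl
  indicator-⇔ f g (yes p) (no nq) = ⊥-elim (nq (f p))
  indicator-⇔ f g (no np) (yes q) = ⊥-elim (np (g q))
  indicator-⇔ f g (no np) (no nq) = refl

  count-∷ : ∀ y a xs → count y (a ∷ xs) ≡ indicator (a ≟ y) ℕ.+ count y xs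
  count-∷ y a xs with a ≟ y
  ... | yes _ = refl
  ... | no _  = refl

  count-concatMap : ∀ {B : Set} y (g : B → List A) xs → count y (concatMap g xs) ≡ sumℕ (map (λ x → count y (g x)) xs)
  count-concatMap y g []       = refl
  count-concatMap y g (x ∷ xs) = trans (count-++ (g x) (concatMap g xs)) (cong (count y (g x) ℕ.+_) (count-concatMap y g xs))
    where
    count-++ : ∀ xs ys → count y (xs ++ ys) ≡ count y xs ℕ.+ count y ys
    count-++ xs ys = trans (cong length (ListP.filter-++ (λ v → v ≟ y) xs ys)) (ListP.length-++ (filter (λ v → v ≟ y) xs))

  count-filter-yes : ∀ {P : Pred A 0ℓ} (P? : Decidable P) y xs → P y → count y (filter P? xs) ≡ count y xs
  count-filter-yes P? y []       p = refl
  count-filter-yes P? y (x ∷ xs) p with P? x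
  ... | yes _ = trans (count-∷ y x (filter P? xs))
                      (trans (cong (indicator (x ≟ y) ℕ.+_) (count-filter-yes P? y xs p)) (sym (count-∷ y x xs)))
  ... | no np = trans (count-filter-yes P? y xs p) (sym (trans (count-∷ y x xs) (cong (ℕ._+ count y xs) x≠y)))
    where
    x≠y : indicator (x ≟ y) ≡ 0
    x≠y with x ≟ y
    ... | yes refl = ⊥-elim (np p)
    ... | no _     = refl

  count-filter-no : ∀ {P : Pred A 0ℓ} (P? : Decidable P) y xs → ¬ P y → count y (filter P? xs) ≡ 0
  count-filter-no P? y []       np = refl
  count-filter-no P? y (x ∷ xs) np with P? x
  ... | no _  = count-filter-no P? y xs np
  ... | yes p = trans (count-∷ y x (filter P? xs)) (cong₂ ℕ._+_ x≠y (count-filter-no P? y xs np))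
    where
    x≠y : indicator (x ≟ y) ≡ 0
    x≠y with x ≟ y
    ... | yes refl = ⊥-elim (np p)
    ... | no _     = refl

  count-swap : ∀ xs ys → sumℕ (map (λ x → count x ys) xs) ≡ sumℕ (map (λ y → count y xs) ys)
  count-swap []       ys = sym (none ys)
    where
    none : ∀ ys → sumℕ (map (λ y → count y []) ys) ≡ 0
    none []       = refl
    none (y ∷ ys) = none ys
  count-swap (x ∷ xs) ys = trans (cong (count x ys ℕ.+_) (count-swap xs ys)) (sym (split ys))
    where
    split : ∀ zs → sumℕ (map (λ y → count y (x ∷ xs)) zs) ≡ count x zs ℕ.+ sumℕ (map (λ y → count y xs) zs)
    split []       = refl
    split (z ∷ zs) = begin
      count z (x ∷ xs) ℕ.+ sumℕ (map (λ y → count y (x ∷ xs)) zs)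
        ≡⟨ cong₂ ℕ._+_ (count-∷ z x xs) (split zs) ⟩
      (indicator (x ≟ z) ℕ.+ count z xs) ℕ.+ (count x zs ℕ.+ sumℕ (map (λ y → count y xs) zs))
        ≡⟨ interchange (indicator (x ≟ z)) (count z xs) (count x zs) _ ⟩
      (indicator (x ≟ z) ℕ.+ count x zs) ℕ.+ (count z xs ℕ.+ sumℕ (map (λ y → count y xs) zs))
        ≡⟨ cong (ℕ._+ (count z xs ℕ.+ sumℕ (map (λ y → count y xs) zs)))
                (trans (cong (ℕ._+ count x zs) (indicator-⇔ sym sym (x ≟ z) (z ≟ x))) (sym (count-∷ x z zs))) ⟩
      count x (z ∷ zs) ℕ.+ (count z xs ℕ.+ sumℕ (map (λ y → count y xs) zs)) ∎
      where open ≡-Reasoning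

module Chamber where

  open import Data.Fin using (Fin; zero; suc; inject₁)
  open import Data.Vec as Vec using ([]; _∷_; lookup; updateAt)
  open import Data.Unit using (⊤; tt)
  open import Data.Nat.Combinatorics using (_C_)
  open import Relation.Binary using (tri<; tri≈; tri>)
  open Embedding using (ιℤ; ιℤ-+)
  open Series using (_≈_)
  open Determinants using (sum)
  open Alternating using (det-equal-adjacent-rows)
  open InitialValues using (besselMatrix)

  shift : Letter → ℤ → ℤ
  shift R x = x ℤ.+ + 1
  shift L x = x ℤ.- + 1

  move : ∀ {n} → Letter → Vec ℤ n → Fin n → Vec ℤ n
  move a v i = updateAt v i (shift a)

  opposite : Letter → Letter
  opposite R = L
  opposite L = R

  shift-opposite : ∀ a x → shift (opposite a) (shift a x) ≡ x
  shift-opposite R x = ℤS.solve 1 (λ x → (x ℤS.:+ ℤS.con (+ 1)) ℤS.:- ℤS.con (+ 1) ℤS.:= x) refl x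
  shift-opposite L x = ℤS.solve 1 (λ x → (x ℤS.:- ℤS.con (+ 1)) ℤS.:+ ℤS.con (+ 1) ℤS.:= x) refl x

  shift-R≢L : ∀ r → shift R r ≢ shift L r
  shift-R≢L r e with trans (ℤS.solve 1 (λ r → ℤS.con (+ 2) ℤS.:= (r ℤS.:+ ℤS.con (+ 1)) ℤS.:- (r ℤS.:- ℤS.con (+ 1))) refl r)
                           (trans (cong (ℤ._- (r ℤ.- + 1)) e) (ℤP.+-inverseʳ (r ℤ.- + 1)))
  ... | ()

  entrySum : ∀ {n} → Vec ℤ n → ℤ
  entrySum = Vec.foldr _ ℤ._+_ (+ 0)

  entrySum-move : ∀ {n} a (v : Vec ℤ n) i → entrySum (move a v i) ≡ shift a (entrySum v)
  entrySum-move a (x ∷ xs) zero = trans (cong (ℤ._+ entrySum xs) (shift-+ a x)) (shift-comm a x (entrySum xs))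
    where
    step-of : Letter → ℤ
    step-of R = + 1
    step-of L = ℤ.- + 1
    shift-+ : ∀ a x → shift a x ≡ x ℤ.+ step-of a
    shift-+ R x = refl
    shift-+ L x = refl
    shift-comm : ∀ a x s → (x ℤ.+ step-of a) ℤ.+ s ≡ shift a (x ℤ.+ s)
    shift-comm a x s = trans (ℤS.solve 3 (λ x c s → (x ℤS.:+ c) ℤS.:+ s ℤS.:= (x ℤS.:+ s) ℤS.:+ c) refl x (step-of a) s) (sym (shift-+ a (x ℤ.+ s)))
  entrySum-move a (x ∷ xs) (suc i) = trans (cong (λ t → x ℤ.+ t) (entrySum-move a xs i)) (shift-assoc a x (entrySum xs))
    where
    shift-assoc : ∀ a x s → x ℤ.+ shift a s ≡ shift a (x ℤ.+ s)
    shift-assoc R x s = sym (ℤP.+-assoc x s (+ 1))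
    shift-assoc L x s = sym (ℤP.+-assoc x s (ℤ.- + 1))

  shift-sub : ∀ a s k → shift a s ℤ.- k ≡ shift a (s ℤ.- k)
  shift-sub R s k = ℤS.solve 2 (λ s k → (s ℤS.:+ ℤS.con (+ 1)) ℤS.:- k ℤS.:= (s ℤS.:- k) ℤS.:+ ℤS.con (+ 1)) refl s k
  shift-sub L s k = ℤS.solve 2 (λ s k → (s ℤS.:- ℤS.con (+ 1)) ℤS.:- k ℤS.:= (s ℤS.:- k) ℤS.:- ℤS.con (+ 1)) refl s k

  ιℤ-entrySum : ∀ {n} (v : Vec ℤ n) → ιℤ (entrySum v) ≡ sum (λ i → ιℤ (lookup v i))
  ιℤ-entrySum []       = refl
  ιℤ-entrySum (x ∷ xs) = trans (ιℤ-+ x (entrySum xs)) (cong (λ t → ιℤ x + t) (ιℤ-entrySum xs))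

  rank-move : ∀ d a (v : Vec ℤ d) i → rank d (move a v i) ≡ shift a (rank d v)
  rank-move d a v i = trans (cong (ℤ._- + (suc d C 2)) (entrySum-move a v i)) (shift-sub a (entrySum v) (+ (suc d C 2)))

  WeaklyDec : ∀ {n} → Vec ℤ n → Set
  WeaklyDec []           = ⊤
  WeaklyDec (x ∷ [])     = ⊤
  WeaklyDec (x ∷ y ∷ xs) = (y ℤ.≤ x) × WeaklyDec (y ∷ xs)

  StrictDec⇒WeaklyDec : ∀ {n} (v : Vec ℤ n) → StrictDec v → WeaklyDec v
  StrictDec⇒WeaklyDec []           _         = tt
  StrictDec⇒WeaklyDec (x ∷ [])     _         = tt
  StrictDec⇒WeaklyDec (x ∷ y ∷ xs) (lt , sd) = ℤP.<⇒≤ lt , StrictDec⇒WeaklyDec (y ∷ xs) sd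

  shift-below : ∀ c {a b} → b ℤ.< a → shift c b ℤ.≤ a
  shift-below R {a} {b} lt = subst (ℤ._≤ a) (ℤP.+-comm (+ 1) b) (ℤP.i<j⇒suc[i]≤j lt)
  shift-below L         lt = ℤP.i≤j⇒i-k≤j (+ 1) (ℤP.<⇒≤ lt)

  shift-above : ∀ c {a b} → b ℤ.< a → b ℤ.≤ shift c a
  shift-above R {a} lt = ℤP.≤-trans (ℤP.<⇒≤ lt) (ℤP.i≤i+j a (+ 1))
  shift-above L {a} {b} lt = subst (ℤ._≤ a ℤ.- + 1) (shift-opposite R b) (ℤP.+-monoˡ-≤ (ℤ.- + 1) (shift-below R lt))

  move-WeaklyDec : ∀ {n} c (v : Vec ℤ n) → StrictDec v → ∀ i → WeaklyDec (move c v i)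
  move-WeaklyDec c (x ∷ [])     sd        zero          = tt
  move-WeaklyDec c (x ∷ y ∷ xs) (lt , sd) zero          = shift-above c lt , StrictDec⇒WeaklyDec (y ∷ xs) sd
  move-WeaklyDec c (x ∷ y ∷ xs) (lt , sd) (suc zero)    = shift-below c lt , move-WeaklyDec c (y ∷ xs) sd zero
  move-WeaklyDec c (x ∷ y ∷ xs) (lt , sd) (suc (suc i)) = ℤP.<⇒≤ lt , move-WeaklyDec c (y ∷ xs) sd (suc i)

  equal-adjacent : ∀ {n} (v : Vec ℤ (suc n)) → WeaklyDec v → ¬ StrictDec v →
    Σ (Fin n) λ k → lookup v (inject₁ k) ≡ lookup v (suc k)
  equal-adjacent (x ∷ [])     _          nsd = ⊥-elim (nsd tt)
  equal-adjacent (x ∷ y ∷ ys) (y≤x , wd) nsd with ℤP.<-cmp y x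
  ... | tri< y<x _ _ = let (k , e) = equal-adjacent (y ∷ ys) wd (λ sd → nsd (y<x , sd)) in suc k , e
  ... | tri≈ _ e _   = zero , sym e
  ... | tri> _ _ x<y = ⊥-elim (ℤP.<-irrefl refl (ℤP.<-≤-trans x<y y≤x))

  -- On the boundary of the chamber F_ν vanishes: two rows of its matrix agree.
  boundary-vanishes : ∀ d (μ ν : Vec ℤ d) → WeaklyDec ν → ¬ StrictDec ν → det d (besselMatrix ν μ) ≈ zeroPS
  boundary-vanishes zero          μ []       wd nsd = ⊥-elim (nsd tt)
  boundary-vanishes (suc zero)    μ (x ∷ []) wd nsd = ⊥-elim (nsd tt)
  boundary-vanishes (suc (suc n)) μ ν        wd nsd =
    det-equal-adjacent-rows n (besselMatrix ν μ) (proj₁ adjacent) (λ b m → cong (λ t → besselI2x (t ℤ.- lookup μ b) m) (proj₂ adjacent))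
    where
    adjacent : Σ (Fin (suc n)) λ k → lookup ν (inject₁ k) ≡ lookup ν (suc k)
    adjacent = equal-adjacent ν wd nsd

module Walks (d : ℕ) where

  open import Data.Fin using (Fin)
  open import Data.Vec as Vec using (lookup; allFin)
  open import Data.Vec.Properties using (≡-dec; updateAt-updateAt; updateAt-id-local)
  open import Data.List using (List; []; _∷_; concatMap; map)
  open import Data.List.Relation.Unary.All as All using (All; []; _∷_)
  import Data.List.Relation.Unary.All.Properties as AllP
  open import Data.Nat.ListAction using () renaming (sum to sumℕ)
  open import Relation.Nullary using (_×-dec_)
  open Chamber

  _≟ᵥ_ : (x y : Vec ℤ d) → Dec (x ≡ y)
  _≟ᵥ_ = ≡-dec ℤ._≟_

  open Counting _≟ᵥ_ public

  sumℕ-cong : ∀ {B : Set} {f g : B → ℕ} (xs : List B) → (∀ x → f x ≡ g x) → sumℕ (map f xs) ≡ sumℕ (map g xs)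
  sumℕ-cong []       h = refl
  sumℕ-cong (x ∷ xs) h = cong₂ ℕ._+_ (h x) (sumℕ-cong xs h)

  sumℕ-cong-All : ∀ {B : Set} {P : B → Set} {f g : B → ℕ} (xs : List B) → All P xs →
    (∀ x → P x → f x ≡ g x) → sumℕ (map f xs) ≡ sumℕ (map g xs)
  sumℕ-cong-All []       []         h = refl
  sumℕ-cong-All (x ∷ xs) (px ∷ pxs) h = cong₂ ℕ._+_ (h x px) (sumℕ-cong-All xs pxs h)

  indices : List (Fin d)
  indices = Vec.toList (allFin d)

  count-candidates : ∀ y x → count y (distOneCandidates x)
    ≡ sumℕ (map (λ i → indicator (move R x i ≟ᵥ y) ℕ.+ indicator (move L x i ≟ᵥ y)) indices)
  count-candidates y x = trans (count-concatMap y (λ i → move R x i ∷ move L x i ∷ []) indices)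
    (sumℕ-cong indices (λ i → trans (count-∷ y (move R x i) (move L x i ∷ []))
      (cong (indicator (move R x i ≟ᵥ y) ℕ.+_) (trans (count-∷ y (move L x i) []) (ℕP.+-identityʳ _)))))

  move-inverse : ∀ a (x l : Vec ℤ d) i → move a x i ≡ l → move (opposite a) l i ≡ x
  move-inverse a x l i refl = trans (updateAt-updateAt i x) (updateAt-id-local i x (shift-opposite a (lookup x i)))

  candidates-symmetric : ∀ x l → count l (distOneCandidates x) ≡ count x (distOneCandidates l)
  candidates-symmetric x l = trans (count-candidates l x) (trans (sumℕ-cong indices swap-terms) (sym (count-candidates x l)))
    where
    swap-terms : ∀ i → indicator (move R x i ≟ᵥ l) ℕ.+ indicator (move L x i ≟ᵥ l)
                     ≡ indicator (move R l i ≟ᵥ x) ℕ.+ indicator (move L l i ≟ᵥ x)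
    swap-terms i = trans
      (cong₂ ℕ._+_ (indicator-⇔ (move-inverse R x l i) (move-inverse L l x i) (move R x i ≟ᵥ l) (move L l i ≟ᵥ x))
                   (indicator-⇔ (move-inverse L x l i) (move-inverse R l x i) (move L x i ≟ᵥ l) (move R l i ≟ᵥ x)))
      (ℕP.+-comm (indicator (move L l i ≟ᵥ x)) _)

  step-R-symmetric : ∀ x l → StrictDec x → StrictDec l → count l (step d R x) ≡ count x (step d L l)
  step-R-symmetric x l sdx sdl with rank d l ℤ.≟ shift R (rank d x)
  ... | yes e = trans (count-filter-yes (λ v → strictDec? v ×-dec (rank d v ℤ.≟ shift R (rank d x))) l (distOneCandidates x) (sdl , e))
    (trans (candidates-symmetric x l)
      (sym (count-filter-yes (λ v → strictDec? v ×-dec (rank d v ℤ.≟ shift L (rank d l))) x (distOneCandidates l)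
             (sdx , trans (sym (shift-opposite R (rank d x))) (cong (shift L) (sym e))))))
  ... | no ne = trans (count-filter-no (λ v → strictDec? v ×-dec (rank d v ℤ.≟ shift R (rank d x))) l (distOneCandidates x) (ne ∘ proj₂))
    (sym (count-filter-no (λ v → strictDec? v ×-dec (rank d v ℤ.≟ shift L (rank d l))) x (distOneCandidates l)
           (λ p → ne (trans (sym (shift-opposite L (rank d l))) (cong (shift R) (sym (proj₂ p)))))))

  step-symmetric : ∀ a x l → StrictDec x → StrictDec l → count l (step d a x) ≡ count x (step d (opposite a) l)
  step-symmetric R x l sdx sdl = step-R-symmetric x l sdx sdl
  step-symmetric L x l sdx sdl = sym (step-R-symmetric l x sdl sdx)

  step-in-chamber : ∀ a u → All StrictDec (step d a u)
  step-in-chamber R u = All.map proj₁ (AllP.all-filter (λ v → strictDec? v ×-dec (rank d v ℤ.≟ shift R (rank d u))) (distOneCandidates u))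
  step-in-chamber L u = All.map proj₁ (AllP.all-filter (λ v → strictDec? v ×-dec (rank d v ℤ.≟ shift L (rank d u))) (distOneCandidates u))

  walk-in-chamber : ∀ W μ → StrictDec μ → All StrictDec (applyWord d W μ)
  walk-in-chamber []      μ sd = sd ∷ []
  walk-in-chamber (a ∷ W) μ sd = concatMap-All (applyWord d W μ)
    where
    concatMap-All : ∀ xs → All StrictDec (concatMap (step d a) xs)
    concatMap-All []       = []
    concatMap-All (x ∷ xs) = AllP.++⁺ (step-in-chamber a x) (concatMap-All xs)

  -- Count the walks a V ending at l by their position before the last step, and
  -- use the symmetry of steps and double counting.
  Z-recursion : ∀ a V μ l → StrictDec μ → StrictDec l →
    Z d (a ∷ V) μ l ≡ sumℕ (map (λ ν → Z d V μ ν) (step d (opposite a) l))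
  Z-recursion a V μ l sdm sdl = trans (count-concatMap l (step d a) (applyWord d V μ))
    (trans (sumℕ-cong-All (applyWord d V μ) (walk-in-chamber V μ sdm) (λ x sdx → step-symmetric a x l sdx sdl))
           (count-swap (applyWord d V μ) (step d (opposite a) l)))

module ListSums where

  open import Data.List using (List; []; _∷_; _++_; filter; concatMap; map)
  open import Data.List.Relation.Unary.All using (All; []; _∷_)
  open import Data.Nat.ListAction using () renaming (sum to sumℕ)
  open import Relation.Unary using (Pred; Decidable)
  open import Level using (0ℓ)
  open import Data.Fin using (Fin; zero; suc)
  import Data.Vec as Vec
  open Embedding
  open Determinants using (sum)

  sumℚ-tabulate : ∀ n {B : Set} (f : Fin n → B) (φ : B → ℚ) → sumℚ (map φ (Vec.toList (Vec.tabulate f))) ≡ sum (φ ∘ f)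
  sumℚ-tabulate zero    f φ = refl
  sumℚ-tabulate (suc n) f φ = cong (λ t → φ (f zero) + t) (sumℚ-tabulate n (f ∘ suc) φ)

  ι-sumℕ : ∀ {A : Set} (f : A → ℕ) xs → ι (sumℕ (map f xs)) ≡ sumℚ (map (ι ∘ f) xs)
  ι-sumℕ f []       = refl
  ι-sumℕ f (x ∷ xs) = trans (ι-+ (f x) _) (cong (λ t → ι (f x) + t) (ι-sumℕ f xs))

  sumℚ-cong-All : ∀ {A : Set} {P : A → Set} {f g : A → ℚ} (xs : List A) → All P xs →
    (∀ x → P x → f x ≡ g x) → sumℚ (map f xs) ≡ sumℚ (map g xs)
  sumℚ-cong-All []       []         h = refl
  sumℚ-cong-All (x ∷ xs) (px ∷ pxs) h = cong₂ _+_ (h x px) (sumℚ-cong-All xs pxs h)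

  sumℚ-cong : ∀ {A : Set} {f g : A → ℚ} (xs : List A) → (∀ x → f x ≡ g x) → sumℚ (map f xs) ≡ sumℚ (map g xs)
  sumℚ-cong []       h = refl
  sumℚ-cong (x ∷ xs) h = cong₂ _+_ (h x) (sumℚ-cong xs h)

  sumℚ-*ˡ : ∀ {A : Set} c (f : A → ℚ) xs → sumℚ (map (λ x → c * f x) xs) ≡ c * sumℚ (map f xs)
  sumℚ-*ˡ c f []       = sym (*-zeroʳ c)
  sumℚ-*ˡ c f (x ∷ xs) = trans (cong (λ t → c * f x + t) (sumℚ-*ˡ c f xs)) (sym (*-distribˡ-+ c (f x) _))

  sumℚ-zero : ∀ {A : Set} {P : A → Set} (f : A → ℚ) xs → All P xs → (∀ x → P x → f x ≡ 0ℚ) → sumℚ (map f xs) ≡ 0ℚ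
  sumℚ-zero f []       []         h = refl
  sumℚ-zero f (x ∷ xs) (px ∷ pxs) h = trans (cong₂ _+_ (h x px) (sumℚ-zero f xs pxs h)) (+-identityˡ 0ℚ)

  sumℚ-filter : ∀ {A : Set} {P : Pred A 0ℓ} (P? : Decidable P) (h : A → ℚ) xs →
    sumℚ (map h (filter P? xs)) ≡ sumℚ (map (λ v → ind (P? v) (h v)) xs)
  sumℚ-filter P? h []       = refl
  sumℚ-filter P? h (x ∷ xs) with P? x
  ... | yes _ = cong (λ t → h x + t) (sumℚ-filter P? h xs)
  ... | no _  = trans (sumℚ-filter P? h xs) (sym (+-identityˡ _))

  sumℚ-concatMap : ∀ {A B : Set} (h : A → ℚ) (g : B → List A) xs →
    sumℚ (map h (concatMap g xs)) ≡ sumℚ (map (λ x → sumℚ (map h (g x))) xs)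
  sumℚ-concatMap h g []       = refl
  sumℚ-concatMap h g (x ∷ xs) = trans (sumℚ-++ (g x) (concatMap g xs)) (cong (λ t → sumℚ (map h (g x)) + t) (sumℚ-concatMap h g xs))
    where
    sumℚ-++ : ∀ xs ys → sumℚ (map h (xs ++ ys)) ≡ sumℚ (map h xs) + sumℚ (map h ys)
    sumℚ-++ []       ys = sym (+-identityˡ _)
    sumℚ-++ (x ∷ xs) ys = trans (cong (λ t → h x + t) (sumℚ-++ xs ys)) (sym (+-assoc (h x) _ _))


module WalkFormula (d : ℕ) (μ : Vec ℤ d) (sdμ : StrictDec μ) where

  import Data.Vec as Vec
  open import Data.List using (List; []; _∷_; filter; map)
  open import Data.List.Relation.Unary.All using (All)
  import Data.List.Relation.Unary.All.Properties as AllP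
  open import Data.Nat.ListAction using () renaming (sum to sumℕ)
  open import Relation.Nullary using (_×-dec_)
  open Embedding
  open Determinants using (sum)
  open Bessel using (ind-no; ind-when; Split; Split-pred; Split-suc)
  open InitialValues using (besselDet-at-0-diagonal; besselDet-at-0-off-diagonal)
  open NeighbourSums μ using (F; K; lower-neighbour-sum; upper-neighbour-sum)
  open Chamber
  open Walks d using (Z-recursion; count-∷; indicator; _≟ᵥ_)
  open ListSums

  IsStep : Letter → Vec ℤ d → Vec ℤ d → Set
  IsStep a l v = StrictDec v × (rank d v ≡ shift a (rank d l))

  isStep? : ∀ a l v → Dec (IsStep a l v)
  isStep? a l v = strictDec? v ×-dec (rank d v ℤ.≟ shift a (rank d l))

  step-as-filter : ∀ a l → step d a l ≡ filter (isStep? a l) (distOneCandidates l)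
  step-as-filter R l = refl
  step-as-filter L l = refl

  step-IsStep : ∀ a l → All (IsStep a l) (step d a l)
  step-IsStep a l = subst (All (IsStep a l)) (sym (step-as-filter a l)) (AllP.all-filter (isStep? a l) (distOneCandidates l))

  -- Summing F over the a-steps from l is summing over all d unit moves: moves that
  -- leave the chamber land on its boundary, where F vanishes.
  step-sum : ∀ a l m → StrictDec l → sumℚ (map (λ ν → F ν m) (step d a l)) ≡ sum (λ i → F (move a l i) m)
  step-sum a l m sdl = begin
    sumℚ (map (λ ν → F ν m) (step d a l))
      ≡⟨ cong (λ xs → sumℚ (map (λ ν → F ν m) xs)) (step-as-filter a l) ⟩
    sumℚ (map (λ ν → F ν m) (filter (isStep? a l) (distOneCandidates l)))
      ≡⟨ sumℚ-filter (isStep? a l) (λ ν → F ν m) (distOneCandidates l) ⟩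
    sumℚ (map (weighted a) (distOneCandidates l))
      ≡⟨ sumℚ-concatMap (weighted a) (λ i → move R l i ∷ move L l i ∷ []) (Vec.toList (Vec.allFin d)) ⟩
    sumℚ (map (λ i → weighted a (move R l i) + (weighted a (move L l i) + 0ℚ)) (Vec.toList (Vec.allFin d)))
      ≡⟨ sumℚ-cong (Vec.toList (Vec.allFin d)) (candidate-pair a) ⟩
    sumℚ (map (λ i → F (move a l i) m) (Vec.toList (Vec.allFin d)))
      ≡⟨ sumℚ-tabulate d (λ i → i) (λ i → F (move a l i) m) ⟩
    sum (λ i → F (move a l i) m) ∎
    where
    open ≡-Reasoning
    weighted : Letter → Vec ℤ d → ℚ
    weighted b v = ind (isStep? b l v) (F v m)
    kept : ∀ b i → weighted b (move b l i) ≡ F (move b l i) m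
    kept b i = ind-when (isStep? b l (move b l i)) _
      (λ not-step → boundary-vanishes d μ (move b l i) (move-WeaklyDec b l sdl i) (λ s → not-step (s , rank-move d b l i)) m)
    dropped : ∀ b i → weighted b (move (opposite b) l i) ≡ 0ℚ
    dropped b i = ind-no (isStep? b l (move (opposite b) l i)) _ (λ p → different b (trans (sym (rank-move d (opposite b) l i)) (proj₂ p)))
      where
      different : ∀ b → shift (opposite b) (rank d l) ≢ shift b (rank d l)
      different R e = shift-R≢L (rank d l) (sym e)
      different L e = shift-R≢L (rank d l) e
    candidate-pair : ∀ b i → weighted b (move R l i) + (weighted b (move L l i) + 0ℚ) ≡ F (move b l i) m
    candidate-pair R i = trans (cong₂ _+_ (kept R i) (trans (+-identityʳ (weighted R (move L l i))) (dropped R i)))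
                               (+-identityʳ (F (move R l i) m))
    candidate-pair L i = trans (cong₂ _+_ (dropped L i) (+-identityʳ (weighted L (move L l i))))
                               (trans (+-identityˡ (weighted L (move L l i))) (kept L i))

  K-rank : ∀ ν → K ν ≡ ιℤ (rank d ν ℤ.- rank d μ)
  K-rank ν = sym (begin
    ιℤ (rank d ν ℤ.- rank d μ)
      ≡⟨ cong ιℤ (ℤS.solve 3 (λ a b c → (a ℤS.:- c) ℤS.:- (b ℤS.:- c) ℤS.:= a ℤS.:- b) refl (entrySum ν) (entrySum μ) _) ⟩
    ιℤ (entrySum ν ℤ.- entrySum μ)
      ≡⟨ ιℤ-- (entrySum ν) (entrySum μ) ⟩
    ιℤ (entrySum ν) - ιℤ (entrySum μ)
      ≡⟨ cong₂ _-_ (ιℤ-entrySum ν) (ιℤ-entrySum μ) ⟩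
    K ν ∎)
    where open ≡-Reasoning

  #R #L len : List Letter → ℕ
  #R = countLetter R
  #L = countLetter L
  len V = #R V ℕ.+ #L V

  net : List Letter → ℤ
  net V = + #R V ℤ.- + #L V

  net-∷ : ∀ a V → net (a ∷ V) ≡ shift a (net V)
  net-∷ R V = ℤS.solve 2 (λ r s → (ℤS.con (+ 1) ℤS.:+ r) ℤS.:- s ℤS.:= (r ℤS.:- s) ℤS.:+ ℤS.con (+ 1)) refl (+ #R V) (+ #L V)
  net-∷ L V = ℤS.solve 2 (λ r s → r ℤS.:- (ℤS.con (+ 1) ℤS.:+ s) ℤS.:= (r ℤS.:- s) ℤS.:- ℤS.con (+ 1)) refl (+ #R V) (+ #L V)

  walk-∷ : ∀ a V l → StrictDec l → net (a ∷ V) ≡ rank d l ℤ.- rank d μ →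
    (∀ ν → StrictDec ν → net V ≡ rank d ν ℤ.- rank d μ → ι (Z d V μ ν) ≡ ι (#R V !) * ι (#L V !) * F ν (len V)) →
    ι (Z d (a ∷ V) μ l) ≡ ι (#R V !) * ι (#L V !) * sumℚ (map (λ ν → F ν (len V)) (step d (opposite a) l))
  walk-∷ a V l sdl e IH = begin
    ι (Z d (a ∷ V) μ l)
      ≡⟨ cong ι (Z-recursion a V μ l sdμ sdl) ⟩
    ι (sumℕ (map (λ ν → Z d V μ ν) (step d (opposite a) l)))
      ≡⟨ ι-sumℕ (λ ν → Z d V μ ν) (step d (opposite a) l) ⟩
    sumℚ (map (λ ν → ι (Z d V μ ν)) (step d (opposite a) l))
      ≡⟨ sumℚ-cong-All _ (step-IsStep (opposite a) l) (λ ν p → IH ν (proj₁ p) (net-at ν (proj₂ p))) ⟩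
    sumℚ (map (λ ν → c * F ν (len V)) (step d (opposite a) l))
      ≡⟨ sumℚ-*ˡ c (λ ν → F ν (len V)) (step d (opposite a) l) ⟩
    c * sumℚ (map (λ ν → F ν (len V)) (step d (opposite a) l)) ∎
    where
    open ≡-Reasoning
    c : ℚ
    c = ι (#R V !) * ι (#L V !)
    net-at : ∀ ν → rank d ν ≡ shift (opposite a) (rank d l) → net V ≡ rank d ν ℤ.- rank d μ
    net-at ν eq = sym (begin
      rank d ν ℤ.- rank d μ                       ≡⟨ cong (ℤ._- rank d μ) eq ⟩
      shift (opposite a) (rank d l) ℤ.- rank d μ  ≡⟨ shift-sub (opposite a) (rank d l) (rank d μ) ⟩
      shift (opposite a) (rank d l ℤ.- rank d μ)  ≡⟨ cong (shift (opposite a)) (trans (sym e) (net-∷ a V)) ⟩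
      shift (opposite a) (shift a (net V))        ≡⟨ shift-opposite a (net V) ⟩
      net V                                       ∎)

  raise-factorial : ∀ r s f → ι (r !) * ι (s !) * (½ * (ι (suc (r ℕ.+ s)) + (ι (suc r) - ι s)) * f) ≡ ι (suc r !) * ι (s !) * f
  raise-factorial r s f = begin
    ι (r !) * ι (s !) * (½ * (ι (suc r ℕ.+ s) + (ι (suc r) - ι s)) * f)
      ≡⟨ cong (λ t → ι (r !) * ι (s !) * (½ * (t + (ι (suc r) - ι s)) * f)) (ι-+ (suc r) s) ⟩
    ι (r !) * ι (s !) * (½ * ((ι (suc r) + ι s) + (ι (suc r) - ι s)) * f)
      ≡⟨ solve 5 (λ x y a b f → x :* y :* (con ½ :* ((a :+ b) :+ (a :- b)) :* f) := a :* x :* y :* f) refl (ι (r !)) (ι (s !)) (ι (suc r)) (ι s) f ⟩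
    ι (suc r) * ι (r !) * ι (s !) * f
      ≡⟨ cong (λ t → t * ι (s !) * f) (sym (ι-* (suc r) (r !))) ⟩
    ι (suc r !) * ι (s !) * f ∎
    where open ≡-Reasoning

  lower-factorial : ∀ r s f → ι (r !) * ι (s !) * (½ * (ι (suc (r ℕ.+ s)) - (ι r - ι (suc s))) * f) ≡ ι (r !) * ι (suc s !) * f
  lower-factorial r s f = begin
    ι (r !) * ι (s !) * (½ * (ι (suc (r ℕ.+ s)) - (ι r - ι (suc s))) * f)
      ≡⟨ cong (λ t → ι (r !) * ι (s !) * (½ * (ι t - (ι r - ι (suc s))) * f)) (sym (ℕP.+-suc r s)) ⟩
    ι (r !) * ι (s !) * (½ * (ι (r ℕ.+ suc s) - (ι r - ι (suc s))) * f)
      ≡⟨ cong (λ t → ι (r !) * ι (s !) * (½ * (t - (ι r - ι (suc s))) * f)) (ι-+ r (suc s)) ⟩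
    ι (r !) * ι (s !) * (½ * ((ι r + ι (suc s)) - (ι r - ι (suc s))) * f)
      ≡⟨ solve 5 (λ x y a b f → x :* y :* (con ½ :* ((a :+ b) :- (a :- b)) :* f) := x :* (b :* y) :* f) refl (ι (r !)) (ι (s !)) (ι r) (ι (suc s)) f ⟩
    ι (r !) * (ι (suc s) * ι (s !)) * f
      ≡⟨ cong (λ t → ι (r !) * t * f) (sym (ι-* (suc s) (s !))) ⟩
    ι (r !) * ι (suc s !) * f ∎
    where open ≡-Reasoning

  K-net : ∀ V l → net V ≡ rank d l ℤ.- rank d μ → K l ≡ ι (#R V) - ι (#L V)
  K-net V l e = trans (K-rank l) (trans (cong ιℤ (sym e)) (ιℤ-- (+ #R V) (+ #L V)))

  walk-formula : ∀ V ν → StrictDec ν → net V ≡ rank d ν ℤ.- rank d μ → ι (Z d V μ ν) ≡ ι (#R V !) * ι (#L V !) * F ν (len V)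
  walk-formula []      ν sdν _ = trans (cong ι (count-∷ ν μ [])) (initial (μ ≟ᵥ ν))
    where
    initial : (p : Dec (μ ≡ ν)) → ι (indicator p ℕ.+ 0) ≡ ι 1 * ι 1 * F ν 0
    initial (yes refl) = sym (trans (cong (ι 1 * ι 1 *_) (besselDet-at-0-diagonal d μ sdμ)) (solve 0 (con (ι 1) :* con (ι 1) :* con 1ℚ := con (ι 1)) refl))
    initial (no ne)    = sym (trans (cong (ι 1 * ι 1 *_) (besselDet-at-0-off-diagonal d ν μ sdν sdμ (ne ∘ sym))) (*-zeroʳ (ι 1 * ι 1)))
  walk-formula (R ∷ V) ν sdν e = begin
    ι (Z d (R ∷ V) μ ν)
      ≡⟨ walk-∷ R V ν sdν e (walk-formula V) ⟩
    c * sumℚ (map (λ ν′ → F ν′ (len V)) (step d L ν))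
      ≡⟨ cong (c *_) (trans (step-sum L ν (len V) sdν) (lower-neighbour-sum ν (len V))) ⟩
    c * (½ * (ι (suc (len V)) + K ν) * F ν (suc (len V)))
      ≡⟨ cong (λ t → c * (½ * (ι (suc (len V)) + t) * F ν (suc (len V)))) (K-net (R ∷ V) ν e) ⟩
    c * (½ * (ι (suc (len V)) + (ι (suc r) - ι s)) * F ν (suc (len V)))
      ≡⟨ raise-factorial r s (F ν (suc (len V))) ⟩
    ι (suc r !) * ι (s !) * F ν (len (R ∷ V)) ∎
    where
    open ≡-Reasoning
    r s : ℕ
    r = #R V
    s = #L V
    c : ℚ
    c = ι (r !) * ι (s !)
  walk-formula (L ∷ V) ν sdν e = begin
    ι (Z d (L ∷ V) μ ν)
      ≡⟨ walk-∷ L V ν sdν e (walk-formula V) ⟩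
    c * sumℚ (map (λ ν′ → F ν′ (len V)) (step d R ν))
      ≡⟨ cong (c *_) (trans (step-sum R ν (len V) sdν) (upper-neighbour-sum ν (len V))) ⟩
    c * (½ * (ι (suc (len V)) - K ν) * F ν (suc (len V)))
      ≡⟨ cong (λ t → c * (½ * (ι (suc (len V)) - t) * F ν (suc (len V)))) (K-net (L ∷ V) ν e) ⟩
    c * (½ * (ι (suc (len V)) - (ι r - ι (suc s))) * F ν (suc (len V)))
      ≡⟨ lower-factorial r s (F ν (suc (len V))) ⟩
    ι (r !) * ι (suc s !) * F ν (suc (len V))
      ≡⟨ cong (λ t → ι (r !) * ι (suc s !) * F ν t) (sym (ℕP.+-suc r s)) ⟩
    ι (r !) * ι (suc s !) * F ν (len (L ∷ V)) ∎
    where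
    open ≡-Reasoning
    r s : ℕ
    r = #R V
    s = #L V
    c : ℚ
    c = ι (r !) * ι (s !)

  Split-shift : ∀ a Δ m → Split (shift a Δ) m → Split Δ (suc m)
  Split-shift R Δ m = Split-suc Δ m
  Split-shift L Δ m = Split-pred Δ m

  F-vanishes : ∀ m ν → StrictDec ν → ¬ Split (rank d ν ℤ.- rank d μ) m → F ν m ≡ 0ℚ
  F-vanishes zero ν sdν ns = at-0 (ν ≟ᵥ μ)
    where
    at-0 : Dec (ν ≡ μ) → F ν 0 ≡ 0ℚ
    at-0 (yes refl) = ⊥-elim (ns (0 , 0 , refl , sym (ℤP.+-inverseʳ (rank d μ))))
    at-0 (no ne)    = besselDet-at-0-off-diagonal d ν μ sdν sdμ ne
  F-vanishes (suc m) ν sdν ns = ι-suc-cancel m (F ν (suc m)) (begin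
    ι (suc m) * F ν (suc m)
      ≡⟨ solve 3 (λ a k f → a :* f := con ½ :* (a :+ k) :* f :+ con ½ :* (a :- k) :* f) refl (ι (suc m)) (K ν) (F ν (suc m)) ⟩
    ½ * (ι (suc m) + K ν) * F ν (suc m) + ½ * (ι (suc m) - K ν) * F ν (suc m)
      ≡⟨ cong₂ _+_ (trans (sym (lower-neighbour-sum ν m)) (trans (sym (step-sum L ν m sdν)) (neighbours-vanish L)))
                   (trans (sym (upper-neighbour-sum ν m)) (trans (sym (step-sum R ν m sdν)) (neighbours-vanish R))) ⟩
    0ℚ + 0ℚ
      ≡⟨ +-identityˡ 0ℚ ⟩
    0ℚ ∎)
    where
    open ≡-Reasoning
    neighbours-vanish : ∀ a → sumℚ (map (λ ν′ → F ν′ m) (step d a ν)) ≡ 0ℚ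
    neighbours-vanish a = sumℚ-zero (λ ν′ → F ν′ m) (step d a ν) (step-IsStep a ν) (λ ν′ p → F-vanishes m ν′ (proj₁ p)
      (λ sp → ns (Split-shift a _ m (subst (λ t → Split t m) (trans (cong (ℤ._- rank d μ) (proj₂ p)) (shift-sub a (rank d ν) (rank d μ))) sp))))

  word-coefficient : ∀ V n k lam → StrictDec lam → + k ≡ rank d lam ℤ.- rank d μ → #L V ≡ n → #R V ≡ n ℕ.+ k →
    ι (Z d V μ lam) ≡ ι (n ! ℕ.* (n ℕ.+ k) !) * F lam (2 ℕ.* n ℕ.+ k)
  word-coefficient V n k lam sdλ e hL hR = begin
    ι (Z d V μ lam)                                  ≡⟨ walk-formula V lam sdλ net≡ ⟩
    ι (#R V !) * ι (#L V !) * F lam (len V)          ≡⟨ cong₂ (λ a b → ι (a !) * ι (b !) * F lam (a ℕ.+ b)) hR hL ⟩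
    ι ((n ℕ.+ k) !) * ι (n !) * F lam (n ℕ.+ k ℕ.+ n) ≡⟨ cong₂ (λ x t → x * F lam t) (trans (*-comm _ (ι (n !))) (sym (ι-* (n !) ((n ℕ.+ k) !))))
                                                                          (ℕS.solve 2 (λ n k → (n ℕS.:+ k) ℕS.:+ n ℕS.:= ℕS.con 2 ℕS.:* n ℕS.:+ k) refl n k) ⟩
    ι (n ! ℕ.* (n ℕ.+ k) !) * F lam (2 ℕ.* n ℕ.+ k)  ∎
    where
    open ≡-Reasoning
    net≡ : net V ≡ rank d lam ℤ.- rank d μ
    net≡ = trans (cong₂ (λ a b → + a ℤ.- + b) hR hL) (trans (ℤS.solve 2 (λ n k → (n ℤS.:+ k) ℤS.:- n ℤS.:= k) refl (+ n) (+ k)) e)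

module LeftHandSide where

  open FiniteSums
  open Bessel using (Split; ind-yes; ind-no)

  Split⇒length : ∀ k m → Split (+ k) m → Σ ℕ λ v → 2 ℕ.* v ℕ.+ k ≡ m
  Split⇒length k m (u , v , uv , e) = v , (begin
    2 ℕ.* v ℕ.+ k   ≡⟨ ℕS.solve 2 (λ v k → ℕS.con 2 ℕS.:* v ℕS.:+ k ℕS.:= (k ℕS.:+ v) ℕS.:+ v) refl v k ⟩
    (k ℕ.+ v) ℕ.+ v ≡⟨ cong (ℕ._+ v) (sym u≡k+v) ⟩
    u ℕ.+ v         ≡⟨ uv ⟩
    m               ∎)
    where
    open ≡-Reasoning
    u≡k+v : u ≡ k ℕ.+ v
    u≡k+v = ℤP.+-injective (trans (ℤS.solve 2 (λ u v → u ℤS.:= (u ℤS.:- v) ℤS.:+ v) refl (+ u) (+ v)) (cong (ℤ._+ + v) e))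

  length⇒Split : ∀ k n m → 2 ℕ.* n ℕ.+ k ≡ m → Split (+ k) m
  length⇒Split k n m e = n ℕ.+ k , n , trans (ℕS.solve 2 (λ n k → (n ℕS.:+ k) ℕS.:+ n ℕS.:= ℕS.con 2 ℕS.:* n ℕS.:+ k) refl n k) e ,
    ℤS.solve 2 (λ n k → (n ℤS.:+ k) ℤS.:- n ℤS.:= k) refl (+ n) (+ k)

  series-coefficient-hit : ∀ k (c : ℕ → ℕ) v m → 2 ℕ.* v ℕ.+ k ≡ m →
    besselSeriesLHS k c m ≡ ((+ c v) ℚ./ (v ! ℕ.* (v ℕ.+ k) !)) {{v !* (v ℕ.+ k) !≢0}}
  series-coefficient-hit k c v m e = trans (Σ≤-as-Σ< m term)
    (trans (Σ<-single (suc m) {term} v (s≤s v≤m) (λ n _ n≢v → ind-no (dec n) (value n) (λ e′ → n≢v (unique n e′))))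
           (ind-yes (dec v) (value v) e))
    where
    dec : ∀ n → Dec (2 ℕ.* n ℕ.+ k ≡ m)
    dec n = 2 ℕ.* n ℕ.+ k ℕ.≟ m
    value term : ℕ → ℚ
    value n = ((+ c n) ℚ./ (n ! ℕ.* (n ℕ.+ k) !)) {{n !* (n ℕ.+ k) !≢0}}
    term n = ind (dec n) (value n)
    v≤m : v ≤ m
    v≤m = subst (v ≤_) e (ℕP.≤-trans (ℕP.m≤m+n v (v ℕ.+ 0)) (ℕP.m≤m+n (2 ℕ.* v) k))
    unique : ∀ n → 2 ℕ.* n ℕ.+ k ≡ m → n ≡ v
    unique n e′ = ℕP.*-cancelˡ-≡ n v 2 (ℕP.+-cancelʳ-≡ k (2 ℕ.* n) (2 ℕ.* v) (trans e′ (sym e)))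

  series-coefficient-miss : ∀ k (c : ℕ → ℕ) m → (∀ n → 2 ℕ.* n ℕ.+ k ≢ m) → besselSeriesLHS k c m ≡ 0ℚ
  series-coefficient-miss k c m none = trans (Σ≤-as-Σ< m term) (Σ<-zero (suc m) {term} (λ n _ → ind-no (dec n) (value n) (none n)))
    where
    dec : ∀ n → Dec (2 ℕ.* n ℕ.+ k ≡ m)
    dec n = 2 ℕ.* n ℕ.+ k ℕ.≟ m
    value term : ℕ → ℚ
    value n = ((+ c n) ℚ./ (n ! ℕ.* (n ℕ.+ k) !)) {{n !* (n ℕ.+ k) !≢0}}
    term n = ind (dec n) (value n)

-- Proposition 2.2.  With k = r(λ) − r(μ) ≥ 0, the coefficient of x^m on the left is
-- Z_d(W_v; μ, λ) / (v! (v+k)!) if m = 2v + k and 0 otherwise; the walk formula and the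
-- vanishing of F_λ off these lengths identify it with [x^m] F_λ.
proposition2p2 :
    (d : ℕ) → 1 ≤ d →
    (μ lam : Vec ℤ d) → InW d μ → InW d lam →
    rank d μ ℤ.≤ rank d lam →
    (W : ℕ → List Letter) →
    (∀ n → countLetter L (W n) ≡ n
         × countLetter R (W n) ≡ n ℕ.+ ∣ rank d lam ℤ.- rank d μ ∣) →
    ∀ m → besselSeriesLHS ∣ rank d lam ℤ.- rank d μ ∣ (λ n → Z d (W n) μ lam) m
          ≡ det d (λ i j → besselI2x (lookup lam i ℤ.- lookup μ j)) m
proposition2p2 d _ μ lam sdμ sdλ rk W hW m = by-split (Split? (+ k) m)
  where
  open Embedding using (ι; /-unique)
  open Bessel using (Split; Split?)
  open NeighbourSums μ using (F)
  open WalkFormula d μ sdμ using (word-coefficient; F-vanishes)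
  open LeftHandSide
  k : ℕ
  k = ∣ rank d lam ℤ.- rank d μ ∣
  k≡Δ : + k ≡ rank d lam ℤ.- rank d μ
  k≡Δ = ℤP.0≤i⇒+∣i∣≡i (ℤP.i≤j⇒0≤j-i rk)
  walks : ℕ → ℕ
  walks n = Z d (W n) μ lam
  at-length : (Σ ℕ λ v → 2 ℕ.* v ℕ.+ k ≡ m) → besselSeriesLHS k walks m ≡ F lam m
  at-length (v , m≡) = trans (series-coefficient-hit k walks v m m≡)
    (/-unique (walks v) (v ! ℕ.* (v ℕ.+ k) !) {{v !* (v ℕ.+ k) !≢0}} (F lam m)
      (trans (word-coefficient (W v) v k lam sdλ k≡Δ (proj₁ (hW v)) (proj₂ (hW v)))
             (cong (λ t → ι (v ! ℕ.* (v ℕ.+ k) !) * F lam t) m≡)))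
  by-split : Dec (Split (+ k) m) → besselSeriesLHS k walks m ≡ F lam m
  by-split (yes split) = at-length (Split⇒length k m split)
  by-split (no ns)     = trans (series-coefficient-miss k walks m (λ n e → ns (length⇒Split k n m e)))
                               (sym (F-vanishes m lam sdλ (ns ∘ subst (λ t → Split t m) (sym k≡Δ))))
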